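{- Let $a,h,d,j,k,t\in\mathbb{N}$ with $a>2$, $j>2$, $a=kj-t$ where $k\geq 1$ and $0\leq t\leq j-1$, $\gcd(a,d)=1$ and $h\geq d$. Let $A=(a,\ ha+d,\ ha+jd)$. Then $$g(A)=\begin{cases}\frac{ha^2}{j}+(j-2)ha+(a-1)d-a & \text{if } t=0,\\[2pt] \frac{ha(a+1)}{j}+(j-3)ha+(a-1)d-a & \text{if } t=1,\\[2pt] \lfloor \frac{a}{j}\rfloor (ha+jd)+(j-2)ha-d-a & \text{if } 2\leq t\leq j-1 \text{ and } hk+d-ht\geq 0.\end{cases}$$ Moreover, if $hk+d-ht\geq 0$, then $$n(A)=\frac{(a-1)(ha+d-1)}{2}-\frac{h(j-1)(a-t)}{2}\Big(\frac{a+t}{j}-1\Big),$$ and \begin{align*} s(A)&=\frac{(ha+d)^2(2a^2-3a+1)}{12}+\frac{h^2a(j-1)^2(k-1)}{6}\Big(jk^2-\frac{jk}{2}-3tk+3t\Big)\\ &\quad-\frac{h(ha+d)(j-1)(k-1)}{6}\Big(2j^2\big(k^2+\frac{k}{4}\big)-2kj\big(3t+\frac{3}{4}\big)+3t(t+1)\Big)\\ &\quad-\frac{a(ha+d)(a-1)}{4}+\frac{ha(j-1)(a-t)}{4}\Big(\frac{a+t}{j}-1\Big)+\frac{a^2-1}{12}. \end{align*}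
   Context: For a vector $A=(a_1,\dots,a_n)$ of positive integers with $\gcd(A)=1$, an integer $a_0\geq 0$ is representable by $A$ if $a_0=\sum_i a_ix_i$ for some $x_i\in\mathbb{N}=\{0,1,2,\dots\}$. Let $\mathcal{NR}(A)$ be the (finite) set of nonnegative integers not representable by $A$. The Frobenius number is $g(A)=\max\mathcal{NR}(A)$, the Sylvester number is $n(A)=\#\mathcal{NR}(A)$, and the Sylvester sum is $s(A)=\sum_{m\in\mathcal{NR}(A)}m$. -}

module Defs where

open import Data.Nat as ℕ using (ℕ; zero; suc; _<_)
open import Data.Integer using (+_)
open import Data.Rational using (ℚ; _/_; _*_; 0ℚ)
open import Data.Vec using (Vec; zipWith; sum)
open import Data.List as List using (List)
open import Data.List.Membership.Propositional using (_∈_)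
open import Data.List.Relation.Unary.Unique.Propositional using (Unique)
open import Data.Product using (∃; _×_)
open import Function.Bundles using (_⇔_)
open import Relation.Nullary using (¬_)
open import Relation.Binary.PropositionalEquality using (_≡_)

Representable : ∀ {n} → Vec ℕ n → ℕ → Set
Representable {n} A m = ∃ λ (x : Vec ℕ n) → sum (zipWith ℕ._*_ A x) ≡ m

IsFrobenius : ∀ {n} → Vec ℕ n → ℕ → Set
IsFrobenius A g = ¬ Representable A g × (∀ m → g < m → Representable A m)

-- L is a duplicate-free enumeration of the (finite) set NR(A);
-- then n(A) = length L and s(A) = sum L.
EnumeratesNR : ∀ {n} → Vec ℕ n → List ℕ → Set
EnumeratesNR A L = Unique L × (∀ m → (m ∈ L) ⇔ (¬ Representable A m))

ℕ→ℚ : ℕ → ℚ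
ℕ→ℚ n = + n / 1

-- division of a rational by a natural number (only used with nonzero divisors)
_/ℕ_ : ℚ → ℕ → ℚ
p /ℕ zero = 0ℚ
p /ℕ suc n = p * (+ 1 / suc n)

infixl 7 _/ℕ_

{-# OPTIONS --safe #-}
module Submission where

-- Write B = h a + d and C = h a + j d. Since x B + y C = h a (x + y) + d (x + j y), reaching the
-- residue class of s d modulo a with B and C costs at least N s = ⌊s/j⌋ + (s mod j) generators, and
-- h t ≤ h k + d shows that reducing x + j y modulo a = k j - t never increases the cost. As
-- gcd (a, d) = 1, the Apéry set of A with respect to a is {N s · h a + s d : s < a}. The Frobenius
-- number is its largest element minus a, attained at s = a - 1 when t ≤ 1 and at the end of the last
-- complete block of j residues when t ≥ 2. n(A) and s(A) follow from the formulas of Selmer and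
-- Tripathi in terms of the Apéry set, with closed forms for the sums of N s, (N s)² and s N s.

open import Defs
open import Level using (0ℓ)
import Algebra.Properties.CommutativeMonoid.Sum as CommutativeMonoidSum
open import Data.Fin using (Fin; toℕ; fromℕ<)
open import Data.Fin.Properties using (toℕ-fromℕ<; toℕ-injective; toℕ<n)
open import Data.Fin.Permutation using (Permutation′; permutation)
import Data.Integer as ℤ
import Data.Integer.DivMod as ℤ
import Data.Integer.Properties as ℤ
open import Data.List using (List; []; _∷_; _++_; length; concat; applyDownFrom)
open import Data.List.Membership.Propositional using (_∈_)
open import Data.List.Membership.Propositional.Properties
  using (∈-applyDownFrom⁺; ∈-applyDownFrom⁻; ∈-concat⁺′; ∈-concat⁻′)
open import Data.List.Properties using (length-++; length-applyDownFrom)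
open import Data.List.Relation.Binary.Disjoint.Propositional using (Disjoint)
import Data.List.Relation.Unary.All.Properties as All
import Data.List.Relation.Unary.AllPairs.Properties as AllPairs
open import Data.List.Relation.Unary.Unique.Propositional using (Unique)
import Data.List.Relation.Unary.Unique.Propositional.Properties as Unique
open import Data.Nat as ℕ using (ℕ; zero; suc; NonZero; z≤n; s≤s)
open import Data.Nat.Coprimality as Coprime using (1-coprimeTo; gcd≡1⇒coprime; coprime-Bézout)
import Data.Nat.DivMod as ℕ
open import Data.Nat.GCD using (module Bézout)
import Data.Nat.GCD as ℕ
open import Data.Nat.ListAction using (sum)
open import Data.Nat.ListAction.Properties using (sum-++)
import Data.Nat.Properties as ℕ
open import Data.Nat.Tactic.RingSolver using () renaming (ring to ℕ-ring)
open import Data.Product using (∃; ∃₂; _×_; _,_; proj₁; proj₂)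
open import Data.Rational as ℚ using (ℚ; mkℚ; 0ℚ; 1ℚ; ½; ↥_; ↧_)
import Data.Rational.Properties as ℚ
open import Data.Sum using (inj₁; inj₂)
open import Data.Vec using (Vec)
open import Function.Bundles using (_⇔_; mk⇔; Equivalence)
open import Relation.Binary.PropositionalEquality
open import Relation.Nullary using (¬_; contradiction; yes; no)
open import Relation.Nullary.Decidable using (dec⇒maybe)
open import Tactic.RingSolver using (solve-∀; solve)
open import Tactic.RingSolver.Core.AlmostCommutativeRing using (AlmostCommutativeRing; fromCommutativeRing)

-- Natural numbers as rationals

ℕ→ℚ≡mkℚ : ∀ n → ℕ→ℚ n ≡ mkℚ (ℤ.+ n) 0 (Coprime.sym (1-coprimeTo n))
ℕ→ℚ≡mkℚ n = ℚ.normalize-coprime _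

ℕ→ℚ-+ : ∀ m n → ℕ→ℚ (m ℕ.+ n) ≡ ℕ→ℚ m ℚ.+ ℕ→ℚ n
ℕ→ℚ-+ m n rewrite ℕ→ℚ≡mkℚ m | ℕ→ℚ≡mkℚ n =
  ℚ./-cong (sym (cong₂ ℤ._+_ (ℤ.*-identityʳ (ℤ.+ m)) (ℤ.*-identityʳ (ℤ.+ n)))) refl

ℕ→ℚ-* : ∀ m n → ℕ→ℚ (m ℕ.* n) ≡ ℕ→ℚ m ℚ.* ℕ→ℚ n
ℕ→ℚ-* m n rewrite ℕ→ℚ≡mkℚ m | ℕ→ℚ≡mkℚ n = ℚ./-cong (ℤ.pos-* m n) refl

ℕ→ℚ-suc : ∀ n → ℕ→ℚ (suc n) ≡ ℕ→ℚ n ℚ.+ 1ℚ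
ℕ→ℚ-suc n = trans (cong ℕ→ℚ (ℕ.+-comm 1 n)) (ℕ→ℚ-+ n 1)

ℕ→ℚ-+* : ∀ x y z → ℕ→ℚ (x ℕ.+ y ℕ.* z) ≡ ℕ→ℚ x ℚ.+ ℕ→ℚ y ℚ.* ℕ→ℚ z
ℕ→ℚ-+* x y z = trans (ℕ→ℚ-+ x (y ℕ.* z)) (cong (ℕ→ℚ x ℚ.+_) (ℕ→ℚ-* y z))

ℕ→ℚ-/ℕ : ∀ m n → ℕ→ℚ m /ℕ suc n ≡ ℤ.+ m ℚ./ suc n
ℕ→ℚ-/ℕ m n = begin
  ℕ→ℚ m ℚ.* (ℤ.+ 1 ℚ./ suc n)
    ≡⟨ cong₂ ℚ._*_ (ℕ→ℚ≡mkℚ m) (ℚ.normalize-coprime (1-coprimeTo (suc n))) ⟩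
  (ℤ.+ m ℤ.* ℤ.+ 1) ℚ./ (1 ℕ.* suc n)
    ≡⟨ ℚ./-cong (ℤ.*-identityʳ (ℤ.+ m)) (ℕ.*-identityˡ (suc n)) ⟩
  ℤ.+ m ℚ./ suc n ∎
  where open ≡-Reasoning

*-/ℕ-cancel : ∀ n .{{_ : NonZero n}} x → (x ℚ.* ℕ→ℚ n) /ℕ n ≡ x
*-/ℕ-cancel (suc n) x = begin
  x ℚ.* ℕ→ℚ (suc n) ℚ.* (ℤ.+ 1 ℚ./ suc n)   ≡⟨ ℚ.*-assoc x _ _ ⟩
  x ℚ.* (ℕ→ℚ (suc n) ℚ.* (ℤ.+ 1 ℚ./ suc n)) ≡⟨ cong (x ℚ.*_) n*1/n≡1 ⟩
  x ℚ.* 1ℚ                                   ≡⟨ ℚ.*-identityʳ x ⟩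
  x                                           ∎
  where
  open ≡-Reasoning
  n*1/n≡1 : ℕ→ℚ (suc n) ℚ.* (ℤ.+ 1 ℚ./ suc n) ≡ 1ℚ
  n*1/n≡1 = trans (cong₂ ℚ._*_ (ℕ→ℚ≡mkℚ (suc n)) (ℚ.normalize-coprime (1-coprimeTo (suc n))))
                  (ℚ.*-inverseʳ (mkℚ (ℤ.+ suc n) 0 (Coprime.sym (1-coprimeTo (suc n)))))

*-cancelʳ-ℕ→ℚ : ∀ n .{{_ : NonZero n}} {x y} → x ℚ.* ℕ→ℚ n ≡ y ℚ.* ℕ→ℚ n → x ≡ y
*-cancelʳ-ℕ→ℚ n {x} {y} eq =
  trans (sym (*-/ℕ-cancel n x)) (trans (cong (_/ℕ n) eq) (*-/ℕ-cancel n y))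

private
  /-common-factor : ∀ (p : ℤ.ℤ) v g m n .{{_ : NonZero n}} → g ≢ 0 →
                    p ℤ.* ℤ.+ g ≡ ℤ.+ m → ℤ.+ suc v ℤ.* ℤ.+ g ≡ ℤ.+ n → p ℤ./ ℤ.+ suc v ≡ ℤ.+ (m ℕ./ n)
  /-common-factor _           v zero    m n g≢0 _    _    = contradiction refl g≢0
  /-common-factor (ℤ.+ u)     v (suc g) m n _   pg≡m qg≡n = begin
    ℤ.+ u ℤ./ ℤ.+ suc v                     ≡⟨ ℤ.div-pos-is-/ℕ (ℤ.+ u) (suc v) ⟩
    ℤ.+ (u ℕ./ suc v)                       ≡⟨ cong ℤ.+_ (sym (ℕ.m*n/o*n≡m/o u (suc g) (suc v))) ⟩
    ℤ.+ (u ℕ.* suc g ℕ./ (suc v ℕ.* suc g)) ≡⟨ cong ℤ.+_ (trans (ℕ./-congˡ ug≡m) (ℕ./-congʳ vg≡n)) ⟩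
    ℤ.+ (m ℕ./ n)                           ∎
    where
    open ≡-Reasoning
    ug≡m : u ℕ.* suc g ≡ m
    ug≡m = ℤ.+-injective (trans (ℤ.pos-* u (suc g)) pg≡m)
    vg≡n : suc v ℕ.* suc g ≡ n
    vg≡n = ℤ.+-injective (trans (ℤ.pos-* (suc v) (suc g)) qg≡n)
  /-common-factor ℤ.-[1+ u ] v (suc g) m n _ () _

floor-/ℕ : ∀ m n .{{_ : NonZero n}} → ℚ.floor (ℕ→ℚ m /ℕ n) ≡ ℤ.+ (m ℕ./ n)
floor-/ℕ m (suc n) = begin
  ℚ.floor (ℕ→ℚ m /ℕ suc n) ≡⟨ cong ℚ.floor (ℕ→ℚ-/ℕ m n) ⟩
  ℚ.floor p                ≡⟨ floor≡↥/↧ p ⟩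
  ↥ p ℤ./ ↧ p              ≡⟨ /-common-factor (↥ p) (ℚ.ℚ.denominator-1 p) (ℕ.gcd m (suc n)) m (suc n)
                                (ℕ.gcd[m,n]≢0 m (suc n) (inj₂ λ ())) (ℚ.↥-/ (ℤ.+ m) (suc n)) (ℚ.↧-/ (ℤ.+ m) (suc n)) ⟩
  ℤ.+ (m ℕ./ suc n)        ∎
  where
  open ≡-Reasoning
  p : ℚ
  p = ℤ.+ m ℚ./ suc n
  floor≡↥/↧ : ∀ q → ℚ.floor q ≡ ↥ q ℤ./ ↧ q
  floor≡↥/↧ (mkℚ _ _ _) = refl

-- Finite sums and polynomial identities over ℚ

ℚ-ring : AlmostCommutativeRing 0ℓ 0ℓ
ℚ-ring = fromCommutativeRing ℚ.+-*-commutativeRing (λ x → dec⇒maybe (0ℚ ℚ.≟ x))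

module FinSum = CommutativeMonoidSum ℚ.+-0-commutativeMonoid

module _ where
  open import Data.Rational using (_+_; _*_; _-_)

  ∑< : ℕ → (ℕ → ℚ) → ℚ
  ∑< zero    f = 0ℚ
  ∑< (suc n) f = ∑< n f + f n

  syntax ∑< n (λ i → e) = ∑[ i < n ] e

  -- The ring solver sees through the INLINE polynomial abbreviations below.
  tri pyr : ℚ → ℚ
  tri x = x * (x - 1ℚ) * ½
  {-# INLINE tri #-}
  pyr x = x * (x - 1ℚ) * (ℕ→ℚ 2 * x - 1ℚ) * (ℤ.+ 1 ℚ./ 6)
  {-# INLINE pyr #-}

  ∑<-cong : ∀ {f g} n → (∀ i → f i ≡ g i) → ∑< n f ≡ ∑< n g
  ∑<-cong zero    f≗g = refl
  ∑<-cong (suc n) f≗g = cong₂ _+_ (∑<-cong n f≗g) (f≗g n)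

  ∑<-+ : ∀ n f g → ∑[ i < n ] (f i + g i) ≡ ∑< n f + ∑< n g
  ∑<-+ zero    f g = refl
  ∑<-+ (suc n) f g = trans (cong (_+ (f n + g n)) (∑<-+ n f g)) (interchange (∑< n f) (∑< n g) (f n) (g n))
    where
    interchange : ∀ x y u v → (x + y) + (u + v) ≡ (x + u) + (y + v)
    interchange = solve-∀ ℚ-ring

  ∑<-- : ∀ n f g → ∑[ i < n ] (f i - g i) ≡ ∑< n f - ∑< n g
  ∑<-- zero    f g = refl
  ∑<-- (suc n) f g = trans (cong (_+ (f n - g n)) (∑<-- n f g)) (interchange (∑< n f) (∑< n g) (f n) (g n))
    where
    interchange : ∀ x y u v → (x - y) + (u - v) ≡ (x + u) - (y + v)
    interchange = solve-∀ ℚ-ring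

  ∑<-*ˡ : ∀ n c f → ∑[ i < n ] (c * f i) ≡ c * ∑< n f
  ∑<-*ˡ zero    c f = sym (ℚ.*-zeroʳ c)
  ∑<-*ˡ (suc n) c f = trans (cong (_+ c * f n) (∑<-*ˡ n c f)) (sym (ℚ.*-distribˡ-+ c (∑< n f) (f n)))

  ∑<-*ʳ : ∀ n c f → ∑[ i < n ] (f i * c) ≡ ∑< n f * c
  ∑<-*ʳ zero    c f = sym (ℚ.*-zeroˡ c)
  ∑<-*ʳ (suc n) c f = trans (cong (_+ f n * c) (∑<-*ʳ n c f)) (sym (ℚ.*-distribʳ-+ c (∑< n f) (f n)))

  ∑<-const : ∀ n c → ∑[ i < n ] c ≡ ℕ→ℚ n * c
  ∑<-const zero    c = sym (ℚ.*-zeroˡ c)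
  ∑<-const (suc n) c = begin
    ∑[ i < n ] c + c          ≡⟨ cong (_+ c) (∑<-const n c) ⟩
    ℕ→ℚ n * c + c             ≡⟨ distrib (ℕ→ℚ n) c ⟩
    (ℕ→ℚ n + 1ℚ) * c          ≡⟨ cong (_* c) (ℕ→ℚ-suc n) ⟨
    ℕ→ℚ (suc n) * c           ∎
    where
    open ≡-Reasoning
    distrib : ∀ x c → x * c + c ≡ (x + 1ℚ) * c
    distrib = solve-∀ ℚ-ring

  ∑<-closed-form : ∀ (F P : ℚ → ℚ) → P 0ℚ ≡ 0ℚ → (∀ x → P x + F x ≡ P (x + 1ℚ)) →
            ∀ n → ∑[ i < n ] F (ℕ→ℚ i) ≡ P (ℕ→ℚ n)
  ∑<-closed-form F P origin step zero    = sym origin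
  ∑<-closed-form F P origin step (suc n) = begin
    ∑[ i < n ] F (ℕ→ℚ i) + F (ℕ→ℚ n) ≡⟨ cong (_+ F (ℕ→ℚ n)) (∑<-closed-form F P origin step n) ⟩
    P (ℕ→ℚ n) + F (ℕ→ℚ n)            ≡⟨ step (ℕ→ℚ n) ⟩
    P (ℕ→ℚ n + 1ℚ)                   ≡⟨ cong P (ℕ→ℚ-suc n) ⟨
    P (ℕ→ℚ (suc n))                  ∎
    where open ≡-Reasoning

  ∑<-id : ∀ n → ∑[ i < n ] ℕ→ℚ i ≡ tri (ℕ→ℚ n)
  ∑<-id = ∑<-closed-form (λ x → x) tri refl (solve-∀ ℚ-ring)

  ∑<-squares : ∀ n → ∑[ i < n ] (ℕ→ℚ i * ℕ→ℚ i) ≡ pyr (ℕ→ℚ n)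
  ∑<-squares = ∑<-closed-form (λ x → x * x) pyr refl (solve-∀ ℚ-ring)

  ∑<-shift : ∀ n g → ∑< (suc n) g ≡ g 0 + ∑[ i < n ] g (suc i)
  ∑<-shift zero    g = ℚ.+-comm 0ℚ (g 0)
  ∑<-shift (suc n) g = trans (cong (_+ g (suc n)) (∑<-shift n g))
                             (ℚ.+-assoc (g 0) (∑[ i < n ] g (suc i)) (g (suc n)))

  ∑<≡FinSum : ∀ n g → ∑< n g ≡ FinSum.sum {n} (λ i → g (toℕ i))
  ∑<≡FinSum zero    g = refl
  ∑<≡FinSum (suc n) g = trans (∑<-shift n g) (cong (g 0 +_) (∑<≡FinSum n (λ i → g (suc i))))

  ∑<-permute : ∀ {n} (σ τ : ℕ → ℕ) → (∀ {i} → i ℕ.< n → σ i ℕ.< n) → (∀ {i} → i ℕ.< n → τ i ℕ.< n) →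
               (∀ {i} → i ℕ.< n → σ (τ i) ≡ i) → (∀ {i} → i ℕ.< n → τ (σ i) ≡ i) →
               ∀ f → ∑[ i < n ] f (σ i) ≡ ∑< n f
  ∑<-permute {n} σ τ σ< τ< στ τσ f = begin
    ∑[ i < n ] f (σ i)                     ≡⟨ ∑<≡FinSum n (λ i → f (σ i)) ⟩
    FinSum.sum {n} (λ i → f (σ (toℕ i)))   ≡⟨ FinSum.sum-cong-≗ {n} (λ i → cong f (sym (toℕ-fromℕ< (σ< (toℕ<n i))))) ⟩
    FinSum.sum {n} (λ i → f (toℕ (σ̂ i)))   ≡⟨ FinSum.sum-permute (λ i → f (toℕ i)) π ⟨
    FinSum.sum {n} (λ i → f (toℕ i))       ≡⟨ ∑<≡FinSum n f ⟨
    ∑< n f                                  ∎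
    where
    open ≡-Reasoning
    σ̂ τ̂ : Fin n → Fin n
    σ̂ i = fromℕ< (σ< (toℕ<n i))
    τ̂ i = fromℕ< (τ< (toℕ<n i))
    σ̂τ̂ : ∀ i → σ̂ (τ̂ i) ≡ i
    σ̂τ̂ i = toℕ-injective (trans (toℕ-fromℕ< _) (trans (cong σ (toℕ-fromℕ< _)) (στ (toℕ<n i))))
    τ̂σ̂ : ∀ i → τ̂ (σ̂ i) ≡ i
    τ̂σ̂ i = toℕ-injective (trans (toℕ-fromℕ< _) (trans (cong τ (toℕ-fromℕ< _)) (τσ (toℕ<n i))))
    π : Permutation′ n
    π = permutation σ̂ τ̂ σ̂τ̂ τ̂σ̂

  ∑<-blocks : ∀ j (f : ℕ → ℚ) (P : ℕ → ℕ → ℚ) → P 0 0 ≡ 0ℚ → (∀ K → P (suc K) 0 ≡ P K j) →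
              (∀ K R → R ℕ.< j → P K R + f (R ℕ.+ K ℕ.* j) ≡ P K (suc R)) →
              ∀ K R → R ℕ.≤ j → ∑< (R ℕ.+ K ℕ.* j) f ≡ P K R
  ∑<-blocks j f P origin carry step zero    zero    _   = sym origin
  ∑<-blocks j f P origin carry step K       (suc R) R<j =
    trans (cong (_+ f (R ℕ.+ K ℕ.* j)) (∑<-blocks j f P origin carry step K R (ℕ.<⇒≤ R<j))) (step K R R<j)
  ∑<-blocks j f P origin carry step (suc K) zero    _   =
    trans (∑<-blocks j f P origin carry step K j ℕ.≤-refl) (sym (carry K))

  ℕ→ℚ-sum-applyDownFrom : ∀ f n → ℕ→ℚ (sum (applyDownFrom f n)) ≡ ∑[ i < n ] ℕ→ℚ (f i)
  ℕ→ℚ-sum-applyDownFrom f zero    = refl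
  ℕ→ℚ-sum-applyDownFrom f (suc n) = begin
    ℕ→ℚ (f n ℕ.+ sum (applyDownFrom f n))     ≡⟨ ℕ→ℚ-+ (f n) _ ⟩
    ℕ→ℚ (f n) + ℕ→ℚ (sum (applyDownFrom f n)) ≡⟨ cong (ℕ→ℚ (f n) +_) (ℕ→ℚ-sum-applyDownFrom f n) ⟩
    ℕ→ℚ (f n) + ∑[ i < n ] ℕ→ℚ (f i)          ≡⟨ ℚ.+-comm (ℕ→ℚ (f n)) _ ⟩
    ∑[ i < n ] ℕ→ℚ (f i) + ℕ→ℚ (f n)          ∎
    where open ≡-Reasoning

  ℕ→ℚ-length-concat : ∀ (xs : ℕ → List ℕ) n →
                      ℕ→ℚ (length (concat (applyDownFrom xs n))) ≡ ∑[ i < n ] ℕ→ℚ (length (xs i))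
  ℕ→ℚ-length-concat xs zero    = refl
  ℕ→ℚ-length-concat xs (suc n) = begin
    ℕ→ℚ (length (xs n ++ ys))                          ≡⟨ cong ℕ→ℚ (length-++ (xs n)) ⟩
    ℕ→ℚ (length (xs n) ℕ.+ length ys)                  ≡⟨ ℕ→ℚ-+ (length (xs n)) _ ⟩
    ℕ→ℚ (length (xs n)) + ℕ→ℚ (length ys)              ≡⟨ cong (ℕ→ℚ (length (xs n)) +_) (ℕ→ℚ-length-concat xs n) ⟩
    ℕ→ℚ (length (xs n)) + ∑[ i < n ] ℕ→ℚ (length (xs i)) ≡⟨ ℚ.+-comm (ℕ→ℚ (length (xs n))) _ ⟩
    ∑[ i < n ] ℕ→ℚ (length (xs i)) + ℕ→ℚ (length (xs n)) ∎
    where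
    open ≡-Reasoning
    ys : List ℕ
    ys = concat (applyDownFrom xs n)

  ℕ→ℚ-sum-concat : ∀ (xs : ℕ → List ℕ) n →
                   ℕ→ℚ (sum (concat (applyDownFrom xs n))) ≡ ∑[ i < n ] ℕ→ℚ (sum (xs i))
  ℕ→ℚ-sum-concat xs zero    = refl
  ℕ→ℚ-sum-concat xs (suc n) = begin
    ℕ→ℚ (sum (xs n ++ ys))                       ≡⟨ cong ℕ→ℚ (sum-++ (xs n) ys) ⟩
    ℕ→ℚ (sum (xs n) ℕ.+ sum ys)                  ≡⟨ ℕ→ℚ-+ (sum (xs n)) _ ⟩
    ℕ→ℚ (sum (xs n)) + ℕ→ℚ (sum ys)              ≡⟨ cong (ℕ→ℚ (sum (xs n)) +_) (ℕ→ℚ-sum-concat xs n) ⟩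
    ℕ→ℚ (sum (xs n)) + ∑[ i < n ] ℕ→ℚ (sum (xs i)) ≡⟨ ℚ.+-comm (ℕ→ℚ (sum (xs n))) _ ⟩
    ∑[ i < n ] ℕ→ℚ (sum (xs i)) + ℕ→ℚ (sum (xs n)) ∎
    where
    open ≡-Reasoning
    ys : List ℕ
    ys = concat (applyDownFrom xs n)

  ℕ→ℚ-sum-progression : ∀ r d q → ℕ→ℚ (sum (applyDownFrom (λ i → r ℕ.+ i ℕ.* d) q)) ≡
                        ℕ→ℚ q * ℕ→ℚ r + tri (ℕ→ℚ q) * ℕ→ℚ d
  ℕ→ℚ-sum-progression r d q = begin
    ℕ→ℚ (sum (applyDownFrom (λ i → r ℕ.+ i ℕ.* d) q)) ≡⟨ ℕ→ℚ-sum-applyDownFrom (λ i → r ℕ.+ i ℕ.* d) q ⟩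
    ∑[ i < q ] ℕ→ℚ (r ℕ.+ i ℕ.* d)                    ≡⟨ ∑<-cong q (λ i → ℕ→ℚ-+* r i d) ⟩
    ∑[ i < q ] (ℕ→ℚ r + ℕ→ℚ i * ℕ→ℚ d)               ≡⟨ ∑<-+ q (λ _ → ℕ→ℚ r) (λ i → ℕ→ℚ i * ℕ→ℚ d) ⟩
    ∑[ i < q ] ℕ→ℚ r + ∑[ i < q ] (ℕ→ℚ i * ℕ→ℚ d)   ≡⟨ cong₂ _+_ (∑<-const q (ℕ→ℚ r)) (∑<-*ʳ q (ℕ→ℚ d) ℕ→ℚ) ⟩
    ℕ→ℚ q * ℕ→ℚ r + ∑[ i < q ] ℕ→ℚ i * ℕ→ℚ d       ≡⟨ cong (λ x → ℕ→ℚ q * ℕ→ℚ r + x * ℕ→ℚ d) (∑<-id q) ⟩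
    ℕ→ℚ q * ℕ→ℚ r + tri (ℕ→ℚ q) * ℕ→ℚ d ∎
    where open ≡-Reasoning

  x≡y+z⇒z≡x-y : ∀ {x} y z → x ≡ y + z → z ≡ x - y
  x≡y+z⇒z≡x-y y z refl = solve (y ∷ z ∷ []) ℚ-ring

  progression-sum-identity : ∀ {w} r q a → w ≡ r + q * a →
    (q * r + tri q * a) * a ≡ (w * w - a * w - (r * r - a * r)) * ½
  progression-sum-identity r q a refl = solve (r ∷ q ∷ a ∷ []) ℚ-ring

  square-expansion : ∀ n s H A D → (n * H * A + s * D) * (n * H * A + s * D) ≡
                     n * n * (H * H * A * A) + n * s * (ℕ→ℚ 2 * H * A * D) + s * s * (D * D)
  square-expansion = solve-∀ ℚ-ring

  -- P J K R is meant to be the sum of F (N s) s over s < R + K J, where N s = ⌊s/J⌋ + (s mod J),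
  -- so that N (R + K J) = R + K for R < J.
  record BlockRecurrence (F : ℚ → ℚ → ℚ) (P : ℚ → ℚ → ℚ → ℚ) : Set where
    field
      origin : ∀ J → P J 0ℚ 0ℚ ≡ 0ℚ
      carry  : ∀ J K → P J (K + 1ℚ) 0ℚ ≡ P J K J
      step   : ∀ J K R → P J K R + F (R + K) (R + K * J) ≡ P J K (R + 1ℚ)

  ∑N-poly ∑N²-poly ∑Ns-poly : ℚ → ℚ → ℚ → ℚ
  ∑N-poly J K R = J * tri K + K * tri J + R * K + tri R
  {-# INLINE ∑N-poly #-}
  ∑N²-poly J K R = J * pyr K + ℕ→ℚ 2 * tri K * tri J + K * pyr J + R * K * K + ℕ→ℚ 2 * K * tri R + pyr R
  {-# INLINE ∑N²-poly #-}
  ∑Ns-poly J K R = J * J * pyr K + (J + 1ℚ) * tri K * tri J + K * pyr J + J * K * K * R + (J + 1ℚ) * K * tri R + pyr R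
  {-# INLINE ∑Ns-poly #-}

  ∑N-recurrence : BlockRecurrence (λ n _ → n) ∑N-poly
  ∑N-recurrence = record { origin = solve-∀ ℚ-ring ; carry = solve-∀ ℚ-ring ; step = solve-∀ ℚ-ring }

  ∑N²-recurrence : BlockRecurrence (λ n _ → n * n) ∑N²-poly
  ∑N²-recurrence = record { origin = solve-∀ ℚ-ring ; carry = solve-∀ ℚ-ring ; step = solve-∀ ℚ-ring }

  ∑Ns-recurrence : BlockRecurrence (λ n s → n * s) ∑Ns-poly
  ∑Ns-recurrence = record { origin = solve-∀ ℚ-ring ; carry = solve-∀ ℚ-ring ; step = solve-∀ ℚ-ring }

  -- The formulas of the theorem; W stands for the term with a division by j
  -- (h a² / j, h a (a + 1) / j, ⌊a / j⌋, (a + t) / j), and x /ℕ n is written x * (1 / n).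
  g-formula-t≡0 g-formula-t≡1 g-formula-t≥2 : (W A H D J : ℚ) → ℚ
  g-formula-t≡0 W A H D J = W + (J - ℕ→ℚ 2) * H * A + (A - ℕ→ℚ 1) * D - A
  {-# INLINE g-formula-t≡0 #-}
  g-formula-t≡1 W A H D J = W + (J - ℕ→ℚ 3) * H * A + (A - ℕ→ℚ 1) * D - A
  {-# INLINE g-formula-t≡1 #-}
  g-formula-t≥2 W A H D J = W * (H * A + J * D) + (J - ℕ→ℚ 2) * H * A - D - A
  {-# INLINE g-formula-t≥2 #-}

  n-formula : (W A H D J t : ℚ) → ℚ
  n-formula W A H D J t =
    ((A - ℕ→ℚ 1) * (H * A + D - ℕ→ℚ 1)) * ½ - ((H * (J - ℕ→ℚ 1) * (A - t)) * ½) * (W - ℕ→ℚ 1)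
  {-# INLINE n-formula #-}

  s-formula : (W A H D J k t : ℚ) → ℚ
  s-formula W A H D J k t =
    let c1 = ℕ→ℚ 1
        c2 = ℕ→ℚ 2
        c3 = ℕ→ℚ 3
        b = H * A + D
        T1 = (b * b * (c2 * A * A - c3 * A + c1)) * (ℤ.+ 1 ℚ./ 12)
        T2 = ((H * H * A * (J - c1) * (J - c1) * (k - c1)) * (ℤ.+ 1 ℚ./ 6))
             * (J * k * k - (J * k) * ½ - c3 * t * k + c3 * t)
        T3 = ((H * b * (J - c1) * (k - c1)) * (ℤ.+ 1 ℚ./ 6))
             * (c2 * J * J * (k * k + k * (ℤ.+ 1 ℚ./ 4))
                - c2 * k * J * (c3 * t + c3 * (ℤ.+ 1 ℚ./ 4))
                + c3 * t * (t + c1))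
        T4 = (A * b * (A - c1)) * (ℤ.+ 1 ℚ./ 4)
        T5 = ((H * A * (J - c1) * (A - t)) * (ℤ.+ 1 ℚ./ 4)) * (W - c1)
        T6 = (A * A - c1) * (ℤ.+ 1 ℚ./ 12)
    in T1 + T2 - T3 - T4 + T5 + T6
  {-# INLINE s-formula #-}

  frobenius-identity-t≡0 : ∀ {G W A H D J k K r} → J ≡ r + 1ℚ → k ≡ K + 1ℚ → A ≡ r + K * J + 1ℚ →
    W ≡ H * A * k → G ≡ (r + K) * H * A + (r + K * J) * D - A → G ≡ g-formula-t≡0 W A H D J
  frobenius-identity-t≡0 {H = H} {D} {K = K} {r} refl refl refl refl refl = solve (H ∷ D ∷ K ∷ r ∷ []) ℚ-ring

  frobenius-identity-t≡1 : ∀ {G W A H D J k K r} → J ≡ r + 1ℚ + 1ℚ → k ≡ K + 1ℚ → A ≡ r + K * J + 1ℚ →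
    W ≡ H * A * k → G ≡ (r + K) * H * A + (r + K * J) * D - A → G ≡ g-formula-t≡1 W A H D J
  frobenius-identity-t≡1 {H = H} {D} {K = K} {r} refl refl refl refl refl = solve (H ∷ D ∷ K ∷ r ∷ []) ℚ-ring

  frobenius-identity-t≥2 : ∀ {G W A H D J K r} → J ≡ r + 1ℚ → W ≡ K + 1ℚ →
    G ≡ (r + K) * H * A + (r + K * J) * D - A → G ≡ g-formula-t≥2 W A H D J
  frobenius-identity-t≥2 {A = A} {H} {D} {K = K} {r} refl refl refl = solve (A ∷ H ∷ D ∷ K ∷ r ∷ []) ℚ-ring

  frobenius-identity-k≡1 : ∀ {G W A H D J r} → A ≡ r + 1ℚ → J ≡ A + ℕ→ℚ 2 → D ≡ H → W ≡ 0ℚ →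
    G ≡ r * H * A + r * D - A → G ≡ g-formula-t≥2 W A H D J
  frobenius-identity-k≡1 {H = H} {r = r} refl refl refl refl refl = solve (H ∷ r ∷ []) ℚ-ring

  sylvester-number-identity : ∀ {W A H D J k K R t} → J ≡ R + t → k ≡ K + 1ℚ → A ≡ R + K * J → W ≡ k →
    n-formula W A H D J t * A ≡ (∑N-poly J K R * H * A + tri A * D) - tri A
  sylvester-number-identity {H = H} {D} {K = K} {R} {t} refl refl refl refl =
    solve (H ∷ D ∷ K ∷ R ∷ t ∷ []) ℚ-ring

  sylvester-sum-identity : ∀ {W A H D J k K R t} → J ≡ R + t → k ≡ K + 1ℚ → A ≡ R + K * J → W ≡ k →
    s-formula W A H D J k t * A ≡
      ((∑N²-poly J K R * (H * H * A * A) + ∑Ns-poly J K R * (ℕ→ℚ 2 * H * A * D) + pyr A * (D * D))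
        - A * (∑N-poly J K R * H * A + tri A * D) - (pyr A - A * tri A)) * ½
  sylvester-sum-identity {H = H} {D} {K = K} {R} {t} refl refl refl refl = polynomial-identity H D K R t
    where
    -- solve-∀ on this closed form is fast, unlike solve on the substituted goal.
    polynomial-identity : ∀ H D K R t → let J = R + t ; A = R + K * J in
      s-formula (K + 1ℚ) A H D J (K + 1ℚ) t * A ≡
        ((∑N²-poly J K R * (H * H * A * A) + ∑Ns-poly J K R * (ℕ→ℚ 2 * H * A * D) + pyr A * (D * D))
          - A * (∑N-poly J K R * H * A + tri A * D) - (pyr A - A * tri A)) * ½
    polynomial-identity = solve-∀ ℚ-ring

open import Data.Nat using (_+_; _*_; _∸_; _/_; _%_; _≤_; _<_; pred)
open import Data.Nat.Properties
open import Data.Nat.DivMod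
open import Data.Nat.Divisibility using (divides-refl)
open import Algebra.Properties.CommutativeSemigroup +-commutativeSemigroup using () renaming (xy∙z≈xz∙y to +-right-comm)
open import Algebra.Properties.CommutativeSemigroup *-commutativeSemigroup using () renaming (xy∙z≈xz∙y to *-right-comm)

-- Residues modulo a

module _ {a : ℕ} .{{_ : NonZero a}} where

  %≡∧≤⇒+* : ∀ {m n} → m % a ≡ n % a → m ≤ n → ∃ λ i → n ≡ m + i * a
  %≡∧≤⇒+* {m} {n} m≡n m≤n = i , (begin
    n                               ≡⟨ m≡m%n+[m/n]*n n a ⟩
    n % a + n / a * a               ≡⟨ cong₂ (λ r q → r + q * a) (sym m≡n) (sym (m+[n∸m]≡n (/-monoˡ-≤ a m≤n))) ⟩
    m % a + (m / a + i) * a         ≡⟨ cong (m % a +_) (*-distribʳ-+ a (m / a) i) ⟩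
    m % a + (m / a * a + i * a)     ≡⟨ +-assoc (m % a) _ _ ⟨
    m % a + m / a * a + i * a       ≡⟨ cong (_+ i * a) (m≡m%n+[m/n]*n m a) ⟨
    m + i * a                       ∎)
    where
    open ≡-Reasoning
    i : ℕ
    i = n / a ∸ m / a

  %≡∧<⇒+≤ : ∀ {m n} → m % a ≡ n % a → m < n → m + a ≤ n
  %≡∧<⇒+≤ {m} m≡n m<n with %≡∧≤⇒+* m≡n (<⇒≤ m<n)
  ... | zero  , n≡m  = contradiction (trans n≡m (+-identityʳ m)) (>⇒≢ m<n)
  ... | suc i , refl = +-monoʳ-≤ m (m≤m+n a (i * a))

  [x%a*y]%a≡[x*y]%a : ∀ x y → x % a * y % a ≡ x * y % a
  [x%a*y]%a≡[x*y]%a x y = begin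
    x % a * y % a              ≡⟨ %-distribˡ-* (x % a) y a ⟩
    x % a % a * (y % a) % a    ≡⟨ cong (λ z → z * (y % a) % a) (m%n%n≡m%n x a) ⟩
    x % a * (y % a) % a        ≡⟨ %-distribˡ-* x y a ⟨
    x * y % a                  ∎
    where open ≡-Reasoning

  [r+q*a]/a≡q : ∀ {r} q → r < a → (r + q * a) / a ≡ q
  [r+q*a]/a≡q {r} q r<a = trans (+-distrib-/-∣ʳ r (divides-refl q)) (cong₂ _+_ (m<n⇒m/n≡0 r<a) (m*n/n≡m q a))

  ℕ→ℚ-divMod : ∀ m → ℕ→ℚ m ≡ ℕ→ℚ (m % a) ℚ.+ ℕ→ℚ (m / a) ℚ.* ℕ→ℚ a
  ℕ→ℚ-divMod m = trans (cong ℕ→ℚ (m≡m%n+[m/n]*n m a)) (ℕ→ℚ-+* (m % a) (m / a) a)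

  %-inverse : ∀ {d} → (∃₂ λ e c → d * e ≡ 1 + c * a) → ∃ λ e → ∀ x → x * d * e % a ≡ x % a
  %-inverse {d} (e , c , de≡) = e , λ x → trans (cong (_% a) (xde≡ x)) ([m+kn]%n≡m%n x (x * c) a)
    where
    xde≡ : ∀ x → x * d * e ≡ x + x * c * a
    xde≡ x = begin
      x * d * e        ≡⟨ *-assoc x d e ⟩
      x * (d * e)      ≡⟨ cong (x *_) de≡ ⟩
      x * (1 + c * a)  ≡⟨ solve (x ∷ c ∷ a ∷ []) ℕ-ring ⟩
      x + x * c * a    ∎
      where open ≡-Reasoning

-- Bézout gives 1 + x a = y d, so e = y, or 1 + y d = x a, so d y ≡ -1 and e = y (a - 1).
coprime⇒inverse : ∀ {a d} → 1 < a → ℕ.gcd a d ≡ 1 → ∃₂ λ e c → d * e ≡ 1 + c * a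
coprime⇒inverse {suc zero}    (s≤s ()) _
coprime⇒inverse {suc (suc b)} {d} _ gcd≡1 with coprime-Bézout (gcd≡1⇒coprime gcd≡1)
... | Bézout.-+ x y 1+xa≡yd = y , x , trans (*-comm d y) (sym 1+xa≡yd)
... | Bézout.+- zero    y ()
... | Bézout.+- (suc x) y 1+yd≡xa = y * suc b , x * suc b + b , +-cancelʳ-≡ (suc b) _ _ (begin
  d * (y * suc b) + suc b                    ≡⟨ solve (d ∷ y ∷ b ∷ []) ℕ-ring ⟩
  (1 + y * d) * suc b                        ≡⟨ cong (_* suc b) 1+yd≡xa ⟩
  suc x * suc (suc b) * suc b                ≡⟨ solve (x ∷ b ∷ []) ℕ-ring ⟩
  1 + (x * suc b + b) * suc (suc b) + suc b  ∎)
  where open ≡-Reasoning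

-- w s (s < a) runs through the Apéry set of A with respect to a, the least elements of the
-- semigroup in each residue class modulo a, and s ↦ w s mod a is a bijection of [0, a).
module AperySet {n} (A : Vec ℕ n) (a : ℕ) .{{_ : NonZero a}} (w : ℕ → ℕ)
  (representable⇔ : ∀ m → Representable A m ⇔ ∃₂ λ s i → s < a × m ≡ w s + i * a)
  (residue-injective : ∀ {s s′} → s < a → s′ < a → w s % a ≡ w s′ % a → s ≡ s′)
  (residue-surjective : ∀ m → ∃ λ s → s < a × w s % a ≡ m % a)
  where

  apery≤representable : ∀ {s m} → s < a → w s % a ≡ m % a → Representable A m → w s ≤ m
  apery≤representable {s} {m} s<a ws≡m rep with Equivalence.to (representable⇔ m) rep
  ... | s′ , i , s′<a , refl =
    subst (λ z → w z ≤ w s′ + i * a) (residue-injective s′<a s<a ws′≡ws) (m≤m+n (w s′) (i * a))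
    where
    ws′≡ws : w s′ % a ≡ w s % a
    ws′≡ws = trans (sym ([m+kn]%n≡m%n (w s′) i a)) (sym ws≡m)

  apery≤⇒representable : ∀ {s m} → s < a → w s % a ≡ m % a → w s ≤ m → Representable A m
  apery≤⇒representable {s} {m} s<a ws≡m ws≤m =
    let i , m≡ = %≡∧≤⇒+* ws≡m ws≤m in Equivalence.from (representable⇔ m) (s , i , s<a , m≡)

  isFrobenius : ∀ {s*} → s* < a → a ≤ w s* → (∀ {s} → s < a → w s ≤ w s*) → IsFrobenius A (w s* ∸ a)
  isFrobenius {s*} s*<a a≤ws* maximal = not-representable , representable-above
    where
    g = w s* ∸ a
    g+a≡ws* : g + a ≡ w s*
    g+a≡ws* = m∸n+n≡m a≤ws*
    not-representable : ¬ Representable A g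
    not-representable rep = <⇒≱ (subst (g <_) g+a≡ws* (m<m+n g (ℕ.>-nonZero⁻¹ a)))
      (apery≤representable s*<a (trans (cong (_% a) (sym g+a≡ws*)) ([m+n]%n≡m%n g a)) rep)
    representable-above : ∀ m → g < m → Representable A m
    representable-above m g<m = let s , s<a , ws≡m = residue-surjective m in
      apery≤⇒representable s<a ws≡m (≮⇒≥ λ m<ws → <⇒≱ g<m (+-cancelʳ-≤ a m g (begin
        m + a  ≤⟨ %≡∧<⇒+≤ (sym ws≡m) m<ws ⟩
        w s    ≤⟨ maximal s<a ⟩
        w s*   ≡⟨ g+a≡ws* ⟨
        g + a  ∎)))
      where open ≤-Reasoning

  class-gaps : ℕ → List ℕ
  class-gaps s = applyDownFrom (λ i → w s % a + i * a) (w s / a)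

  gaps : List ℕ
  gaps = concat (applyDownFrom class-gaps a)

  ∈class-gaps⇔ : ∀ {m s} → m ∈ class-gaps s ⇔ (w s % a ≡ m % a × m < w s)
  ∈class-gaps⇔ {m} {s} = mk⇔ to from
    where
    r = w s % a
    q = w s / a
    to : m ∈ class-gaps s → w s % a ≡ m % a × m < w s
    to m∈ with ∈-applyDownFrom⁻ (λ i → r + i * a) m∈
    ... | i , i<q , refl = sym (trans ([m+kn]%n≡m%n r i a) (m%n%n≡m%n (w s) a)) , (begin-strict
      r + i * a  <⟨ +-monoʳ-< r (*-monoˡ-< a i<q) ⟩
      r + q * a  ≡⟨ m≡m%n+[m/n]*n (w s) a ⟨
      w s        ∎)
      where open ≤-Reasoning
    from : w s % a ≡ m % a × m < w s → m ∈ class-gaps s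
    from (ws≡m , m<ws) = subst (_∈ class-gaps s) (sym m≡) (∈-applyDownFrom⁺ (λ i → r + i * a) m/a<q)
      where
      m≡ : m ≡ r + m / a * a
      m≡ = trans (m≡m%n+[m/n]*n m a) (cong (_+ m / a * a) (sym ws≡m))
      m/a<q : m / a < q
      m/a<q = *-cancelʳ-< a (m / a) q (+-cancelˡ-< r _ _ (subst₂ _<_ m≡ (m≡m%n+[m/n]*n (w s) a) m<ws))

  ∈gaps⇔ : ∀ m → m ∈ gaps ⇔ (¬ Representable A m)
  ∈gaps⇔ m = mk⇔ to from
    where
    to : m ∈ gaps → ¬ Representable A m
    to m∈ rep =
      let xs , m∈xs , xs∈ = ∈-concat⁻′ (applyDownFrom class-gaps a) m∈
          s , s<a , xs≡ = ∈-applyDownFrom⁻ class-gaps xs∈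
          ws≡m , m<ws = Equivalence.to ∈class-gaps⇔ (subst (m ∈_) xs≡ m∈xs)
      in <⇒≱ m<ws (apery≤representable s<a ws≡m rep)
    from : ¬ Representable A m → m ∈ gaps
    from not-rep = let s , s<a , ws≡m = residue-surjective m in
      ∈-concat⁺′ (Equivalence.from ∈class-gaps⇔ (ws≡m , ≰⇒> λ ws≤m → not-rep (apery≤⇒representable s<a ws≡m ws≤m)))
                 (∈-applyDownFrom⁺ class-gaps s<a)

  gaps-unique : Unique gaps
  gaps-unique = Unique.concat⁺ (All.applyDownFrom⁺₂ class-gaps a class-gaps-unique)
                               (AllPairs.applyDownFrom⁺₁ class-gaps a class-gaps-disjoint)
    where
    class-gaps-unique : ∀ s → Unique (class-gaps s)
    class-gaps-unique s = Unique.applyDownFrom⁺₁ _ (w s / a) λ j<i _ eq →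
      <⇒≢ j<i (sym (*-cancelʳ-≡ _ _ a (+-cancelˡ-≡ (w s % a) _ _ eq)))
    class-gaps-disjoint : ∀ {s s′} → s′ < s → s < a → Disjoint (class-gaps s) (class-gaps s′)
    class-gaps-disjoint s′<s s<a (m∈ , m∈′) =
      <⇒≢ s′<s (residue-injective (<-trans s′<s s<a) s<a
        (trans (proj₁ (Equivalence.to ∈class-gaps⇔ m∈′)) (sym (proj₁ (Equivalence.to ∈class-gaps⇔ m∈)))))

  gaps-enumerate : EnumeratesNR A gaps
  gaps-enumerate = gaps-unique , ∈gaps⇔

  ∑<-residues : ∀ f → ∑[ s < a ] f (w s % a) ≡ ∑< a f
  ∑<-residues = ∑<-permute (λ s → w s % a) class (λ _ → m%n<n _ a) (λ {m} _ → proj₁ (proj₂ (residue-surjective m)))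
    (λ {m} m<a → trans (proj₂ (proj₂ (residue-surjective m))) (m<n⇒m%n≡m m<a))
    (λ {s} s<a → residue-injective (proj₁ (proj₂ (residue-surjective (w s % a)))) s<a
                   (trans (proj₂ (proj₂ (residue-surjective (w s % a)))) (m%n%n≡m%n (w s) a)))
    where
    class : ℕ → ℕ
    class m = proj₁ (residue-surjective m)

  selmer : ℕ→ℚ (length gaps) ℚ.* ℕ→ℚ a ≡ ∑[ s < a ] ℕ→ℚ (w s) ℚ.- tri (ℕ→ℚ a)
  selmer = begin
    ℕ→ℚ (length gaps) ℚ.* qa                         ≡⟨ cong (ℚ._* qa) (ℕ→ℚ-length-concat class-gaps a) ⟩
    ∑[ s < a ] ℕ→ℚ (length (class-gaps s)) ℚ.* qa     ≡⟨ cong (ℚ._* qa) (∑<-cong a λ s → cong ℕ→ℚ (length-applyDownFrom _ (w s / a))) ⟩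
    ∑[ s < a ] ℕ→ℚ (w s / a) ℚ.* qa                  ≡⟨ ∑<-*ʳ a qa (λ s → ℕ→ℚ (w s / a)) ⟨
    ∑[ s < a ] (ℕ→ℚ (w s / a) ℚ.* qa)                ≡⟨ ∑<-cong a (λ s → x≡y+z⇒z≡x-y (ℕ→ℚ (w s % a)) _ (ℕ→ℚ-divMod (w s))) ⟩
    ∑[ s < a ] (ℕ→ℚ (w s) ℚ.- ℕ→ℚ (w s % a))          ≡⟨ ∑<-- a (λ s → ℕ→ℚ (w s)) (λ s → ℕ→ℚ (w s % a)) ⟩
    ∑[ s < a ] ℕ→ℚ (w s) ℚ.- ∑[ s < a ] ℕ→ℚ (w s % a) ≡⟨ cong (λ x → ∑[ s < a ] ℕ→ℚ (w s) ℚ.- x) (trans (∑<-residues ℕ→ℚ) (∑<-id a)) ⟩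
    ∑[ s < a ] ℕ→ℚ (w s) ℚ.- tri qa ∎
    where
    open ≡-Reasoning
    qa : ℚ
    qa = ℕ→ℚ a

  tripathi : ℕ→ℚ (sum gaps) ℚ.* ℕ→ℚ a ≡
    (∑[ s < a ] (ℕ→ℚ (w s) ℚ.* ℕ→ℚ (w s)) ℚ.- ℕ→ℚ a ℚ.* ∑[ s < a ] ℕ→ℚ (w s)
      ℚ.- (pyr (ℕ→ℚ a) ℚ.- ℕ→ℚ a ℚ.* tri (ℕ→ℚ a))) ℚ.* ½
  tripathi = begin
    ℕ→ℚ (sum gaps) ℚ.* qa                                    ≡⟨ cong (ℚ._* qa) (ℕ→ℚ-sum-concat class-gaps a) ⟩
    ∑[ s < a ] ℕ→ℚ (sum (class-gaps s)) ℚ.* qa                ≡⟨ ∑<-*ʳ a qa (λ s → ℕ→ℚ (sum (class-gaps s))) ⟨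
    ∑[ s < a ] (ℕ→ℚ (sum (class-gaps s)) ℚ.* qa)              ≡⟨ ∑<-cong a class-sum ⟩
    ∑[ s < a ] ((F (ℕ→ℚ (w s)) ℚ.- F (ℕ→ℚ (w s % a))) ℚ.* ½) ≡⟨ ∑<-*ʳ a ½ (λ s → F (ℕ→ℚ (w s)) ℚ.- F (ℕ→ℚ (w s % a))) ⟩
    ∑[ s < a ] (F (ℕ→ℚ (w s)) ℚ.- F (ℕ→ℚ (w s % a))) ℚ.* ½   ≡⟨ cong (ℚ._* ½) (∑<-- a (λ s → F (ℕ→ℚ (w s))) (λ s → F (ℕ→ℚ (w s % a)))) ⟩
    (∑[ s < a ] F (ℕ→ℚ (w s)) ℚ.- ∑[ s < a ] F (ℕ→ℚ (w s % a))) ℚ.* ½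
      ≡⟨ cong (λ x → (∑[ s < a ] F (ℕ→ℚ (w s)) ℚ.- x) ℚ.* ½) (∑<-residues (λ s → F (ℕ→ℚ s))) ⟩
    (∑[ s < a ] F (ℕ→ℚ (w s)) ℚ.- ∑[ s < a ] F (ℕ→ℚ s)) ℚ.* ½
      ≡⟨ cong₂ (λ x y → (x ℚ.- y) ℚ.* ½) (∑F (λ s → ℕ→ℚ (w s))) (∑F ℕ→ℚ) ⟩
    (∑[ s < a ] (ℕ→ℚ (w s) ℚ.* ℕ→ℚ (w s)) ℚ.- qa ℚ.* ∑[ s < a ] ℕ→ℚ (w s)
      ℚ.- (∑[ s < a ] (ℕ→ℚ s ℚ.* ℕ→ℚ s) ℚ.- qa ℚ.* ∑[ s < a ] ℕ→ℚ s)) ℚ.* ½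
      ≡⟨ cong₂ (λ x y → (∑[ s < a ] (ℕ→ℚ (w s) ℚ.* ℕ→ℚ (w s)) ℚ.- qa ℚ.* ∑[ s < a ] ℕ→ℚ (w s) ℚ.- (x ℚ.- qa ℚ.* y)) ℚ.* ½)
               (∑<-squares a) (∑<-id a) ⟩
    (∑[ s < a ] (ℕ→ℚ (w s) ℚ.* ℕ→ℚ (w s)) ℚ.- qa ℚ.* ∑[ s < a ] ℕ→ℚ (w s)
      ℚ.- (pyr qa ℚ.- qa ℚ.* tri qa)) ℚ.* ½ ∎
    where
    open ≡-Reasoning
    qa : ℚ
    qa = ℕ→ℚ a
    F : ℚ → ℚ
    F x = x ℚ.* x ℚ.- qa ℚ.* x
    class-sum : ∀ s → ℕ→ℚ (sum (class-gaps s)) ℚ.* qa ≡ (F (ℕ→ℚ (w s)) ℚ.- F (ℕ→ℚ (w s % a))) ℚ.* ½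
    class-sum s = trans (cong (ℚ._* qa) (ℕ→ℚ-sum-progression (w s % a) a (w s / a)))
                        (progression-sum-identity (ℕ→ℚ (w s % a)) (ℕ→ℚ (w s / a)) qa (ℕ→ℚ-divMod (w s)))
    ∑F : ∀ f → ∑[ s < a ] F (f s) ≡ ∑[ s < a ] (f s ℚ.* f s) ℚ.- qa ℚ.* ∑< a f
    ∑F f = trans (∑<-- a (λ s → f s ℚ.* f s) (λ s → qa ℚ.* f s)) (cong (λ x → ∑[ s < a ] (f s ℚ.* f s) ℚ.- x) (∑<-*ˡ a qa f))

-- N s = ⌊s/j⌋ + (s mod j) is the least number of coins of values 1 and j that add up to s.
module CoinCount (j : ℕ) .{{_ : NonZero j}} where

  N : ℕ → ℕ
  N s = s / j + s % j

  N-digits : ∀ {r} q → r < j → N (r + q * j) ≡ r + q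
  N-digits {r} q r<j = begin
    (r + q * j) / j + (r + q * j) % j ≡⟨ cong₂ _+_ ([r+q*a]/a≡q q r<j) (trans ([m+kn]%n≡m%n r q j) (m<n⇒m%n≡m r<j)) ⟩
    q + r                               ≡⟨ +-comm q r ⟩
    r + q                               ∎
    where open ≡-Reasoning

  N-small : ∀ {s} → s < j → N s ≡ s
  N-small {s} s<j = trans (cong N (sym (+-identityʳ s))) (trans (N-digits 0 s<j) (+-identityʳ s))

  N-+* : ∀ x y → N (x + y * j) ≡ N x + y
  N-+* x y = begin
    N (x + y * j)                   ≡⟨ cong (λ z → N (z + y * j)) (m≡m%n+[m/n]*n x j) ⟩
    N (x % j + x / j * j + y * j)   ≡⟨ cong N (trans (+-assoc (x % j) _ _) (cong (x % j +_) (sym (*-distribʳ-+ j (x / j) y)))) ⟩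
    N (x % j + (x / j + y) * j)     ≡⟨ N-digits (x / j + y) (m%n<n x j) ⟩
    x % j + (x / j + y)             ≡⟨ +-assoc (x % j) (x / j) y ⟨
    x % j + x / j + y               ≡⟨ cong (_+ y) (+-comm (x % j) (x / j)) ⟩
    N x + y                         ∎
    where open ≡-Reasoning

  N≤ : ∀ x → N x ≤ x
  N≤ x = begin
    x / j + x % j      ≤⟨ +-monoˡ-≤ (x % j) (m≤m*n (x / j) j) ⟩
    x / j * j + x % j  ≡⟨ +-comm (x / j * j) (x % j) ⟩
    x % j + x / j * j  ≡⟨ m≡m%n+[m/n]*n x j ⟨
    x                  ∎
    where open ≤-Reasoning

  N-minimal : ∀ x y → N (x + y * j) ≤ x + y
  N-minimal x y = subst (_≤ x + y) (sym (N-+* x y)) (+-monoˡ-≤ y (N≤ x))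

  N-+-≤ : ∀ v c → N (v + c) ≤ N v + c
  N-+-≤ v c = begin
    N (v + c)                   ≡⟨ cong (λ z → N (z + c)) (m≡m%n+[m/n]*n v j) ⟩
    N (v % j + v / j * j + c)   ≡⟨ cong N (+-right-comm (v % j) (v / j * j) c) ⟩
    N (v % j + c + v / j * j)   ≡⟨ N-+* (v % j + c) (v / j) ⟩
    N (v % j + c) + v / j       ≤⟨ +-monoˡ-≤ (v / j) (N≤ (v % j + c)) ⟩
    v % j + c + v / j           ≡⟨ +-right-comm (v % j) c (v / j) ⟩
    v % j + v / j + c           ≡⟨ cong (_+ c) (+-comm (v % j) (v / j)) ⟩
    N v + c                     ∎
    where open ≤-Reasoning

  N-max : ∀ {r K s} → r < j → j ≤ suc (suc r) → s ≤ r + K * j → N s ≤ r + K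
  N-max {r} {K} {s} r<j j≤r+2 s≤r+Kj with m≤n⇒m<n∨m≡n q≤K
    where
    q : ℕ
    q = s / j
    q≤K : q ≤ K
    q≤K = ≤-pred (m<n*o⇒m/o<n (<-≤-trans (s≤s s≤r+Kj) (+-monoˡ-≤ (K * j) r<j)))
  ... | inj₁ q<K = begin
    s / j + s % j   ≤⟨ +-monoʳ-≤ (s / j) (≤-pred (≤-trans (m%n<n s j) j≤r+2)) ⟩
    s / j + suc r   ≡⟨ +-suc (s / j) r ⟩
    suc (s / j) + r ≤⟨ +-monoˡ-≤ r q<K ⟩
    K + r           ≡⟨ +-comm K r ⟩
    r + K           ∎
    where open ≤-Reasoning
  ... | inj₂ q≡K = begin
    s / j + s % j   ≡⟨ cong (_+ s % j) q≡K ⟩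
    K + s % j       ≤⟨ +-monoʳ-≤ K (+-cancelʳ-≤ (K * j) (s % j) r (begin
                         s % j + K * j      ≡⟨ cong (λ z → s % j + z * j) q≡K ⟨
                         s % j + s / j * j  ≡⟨ m≡m%n+[m/n]*n s j ⟨
                         s                  ≤⟨ s≤r+Kj ⟩
                         r + K * j          ∎)) ⟩
    K + r           ≡⟨ +-comm K r ⟩
    r + K           ∎
    where open ≤-Reasoning

  ∑<-N-closed-form : ∀ {F P} → BlockRecurrence F P → ∀ K R → R ≤ j →
         ∑[ s < R + K * j ] F (ℕ→ℚ (N s)) (ℕ→ℚ s) ≡ P (ℕ→ℚ j) (ℕ→ℚ K) (ℕ→ℚ R)
  ∑<-N-closed-form {F} {P} recurrence = ∑<-blocks j (λ s → F (ℕ→ℚ (N s)) (ℕ→ℚ s)) (λ K R → P qj (ℕ→ℚ K) (ℕ→ℚ R))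
    (origin qj)
    (λ K → trans (cong (λ κ → P qj κ 0ℚ) (ℕ→ℚ-suc K)) (carry qj (ℕ→ℚ K)))
    λ K R R<j → begin
      P qj (ℕ→ℚ K) (ℕ→ℚ R) ℚ.+ F (ℕ→ℚ (N (R + K * j))) (ℕ→ℚ (R + K * j))
        ≡⟨ cong₂ (λ n s → P qj (ℕ→ℚ K) (ℕ→ℚ R) ℚ.+ F n s)
                 (trans (cong ℕ→ℚ (N-digits K R<j)) (ℕ→ℚ-+ R K)) (ℕ→ℚ-+* R K j) ⟩
      P qj (ℕ→ℚ K) (ℕ→ℚ R) ℚ.+ F (ℕ→ℚ R ℚ.+ ℕ→ℚ K) (ℕ→ℚ R ℚ.+ ℕ→ℚ K ℚ.* qj)
        ≡⟨ step qj (ℕ→ℚ K) (ℕ→ℚ R) ⟩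
      P qj (ℕ→ℚ K) (ℕ→ℚ R ℚ.+ 1ℚ)
        ≡⟨ cong (P qj (ℕ→ℚ K)) (ℕ→ℚ-suc R) ⟨
      P qj (ℕ→ℚ K) (ℕ→ℚ (suc R)) ∎
    where
    open BlockRecurrence recurrence
    open ≡-Reasoning
    qj : ℚ
    qj = ℕ→ℚ j

-- The semigroup generated by a, h a + d and h a + j d

gcd≡1⇒1≤d : ∀ {a d} → 1 < a → ℕ.gcd a d ≡ 1 → 1 ≤ d
gcd≡1⇒1≤d {a} {zero}  1<a gcd≡1 = contradiction (trans (sym (ℕ.gcd-identityʳ a)) gcd≡1) (>⇒≢ 1<a)
gcd≡1⇒1≤d {d = suc _} _   _     = s≤s z≤n

cost-scaling : ∀ {h n m l k t d} → n + l * k ≤ m + l * t → h * t ≤ h * k + d → h * n ≤ h * m + l * d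
cost-scaling {h} {n} {m} {l} {k} {t} {d} n+lk≤m+lt ht≤hk+d = +-cancelʳ-≤ (l * (h * k)) (h * n) (h * m + l * d) (begin
  h * n + l * (h * k)         ≡⟨ solve (h ∷ n ∷ l ∷ k ∷ []) ℕ-ring ⟩
  h * (n + l * k)             ≤⟨ *-monoʳ-≤ h n+lk≤m+lt ⟩
  h * (m + l * t)             ≡⟨ solve (h ∷ m ∷ l ∷ t ∷ []) ℕ-ring ⟩
  h * m + l * (h * t)         ≤⟨ +-monoʳ-≤ (h * m) (*-monoʳ-≤ l ht≤hk+d) ⟩
  h * m + l * (h * k + d)     ≡⟨ solve (h ∷ m ∷ l ∷ k ∷ d ∷ []) ℕ-ring ⟩
  h * m + l * d + l * (h * k) ∎)
  where open ≤-Reasoning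

apery-form-arith : ∀ a h d j x₀ x₁ x₂ s l n δ → x₁ + x₂ * j ≡ s + l * a → h * n + δ ≡ h * (x₁ + x₂) + l * d →
              a * x₀ + ((h * a + d) * x₁ + ((h * a + j * d) * x₂ + 0)) ≡ n * h * a + s * d + (x₀ + δ) * a
apery-form-arith a h d j x₀ x₁ x₂ s l n δ u≡ cost≡ = begin
  a * x₀ + ((h * a + d) * x₁ + ((h * a + j * d) * x₂ + 0)) ≡⟨ solve (a ∷ h ∷ d ∷ j ∷ x₀ ∷ x₁ ∷ x₂ ∷ []) ℕ-ring ⟩
  a * x₀ + h * a * (x₁ + x₂) + (x₁ + x₂ * j) * d          ≡⟨ cong (λ u → a * x₀ + h * a * (x₁ + x₂) + u * d) u≡ ⟩
  a * x₀ + h * a * (x₁ + x₂) + (s + l * a) * d            ≡⟨ solve (a ∷ h ∷ d ∷ x₀ ∷ x₁ ∷ x₂ ∷ s ∷ l ∷ []) ℕ-ring ⟩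
  s * d + (x₀ + (h * (x₁ + x₂) + l * d)) * a               ≡⟨ cong (λ c → s * d + (x₀ + c) * a) cost≡ ⟨
  s * d + (x₀ + (h * n + δ)) * a                           ≡⟨ solve (a ∷ h ∷ d ∷ x₀ ∷ s ∷ n ∷ δ ∷ []) ℕ-ring ⟩
  n * h * a + s * d + (x₀ + δ) * a                         ∎
  where open ≡-Reasoning

apery-combination-arith : ∀ a h d j i r q →
  a * i + ((h * a + d) * r + ((h * a + j * d) * q + 0)) ≡ (q + r) * h * a + (r + q * j) * d + i * a
apery-combination-arith = solve-∀ ℕ-ring

last-block-arith : ∀ ρ c K′ h a d {j j′} → j ≡ suc j′ → j′ ≡ 2 + (ρ + c) →
  (j′ + K′) * h * a + (j′ + K′ * j) * d + suc ρ * d ≡ (ρ + suc K′) * h * a + (ρ + suc K′ * j) * d + suc c * (h * a)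
last-block-arith ρ c K′ h a d refl refl = solve (ρ ∷ c ∷ K′ ∷ h ∷ a ∷ d ∷ []) ℕ-ring

k≡1⇒t≡2∧d≡h : ∀ {h d t} → 1 ≤ h → d ≤ h → 2 ≤ t → h * t ≤ h * 1 + d → t ≡ 2 × d ≡ h
k≡1⇒t≡2∧d≡h {t = suc zero} _ _ (s≤s ()) _
k≡1⇒t≡2∧d≡h {h} {d} {suc (suc t₂)} 1≤h d≤h _ ht≤h+d = cong (2 +_) t₂≡0 , ≤-antisym d≤h h≤d
  where
  h+ht₂≤d : h + h * t₂ ≤ d
  h+ht₂≤d = +-cancelˡ-≤ h _ _ (begin
    h + (h + h * t₂)  ≡⟨ solve (h ∷ t₂ ∷ []) ℕ-ring ⟩
    h * (2 + t₂)      ≤⟨ ht≤h+d ⟩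
    h * 1 + d         ≡⟨ cong (_+ d) (*-identityʳ h) ⟩
    h + d             ∎)
    where open ≤-Reasoning
  h≤d : h ≤ d
  h≤d = ≤-trans (m≤m+n h (h * t₂)) h+ht₂≤d
  ht₂≡0 : h * t₂ ≡ 0
  ht₂≡0 = n≤0⇒n≡0 (+-cancelˡ-≤ h _ _ (subst (h + h * t₂ ≤_) (sym (+-identityʳ h)) (≤-trans h+ht₂≤d d≤h)))
  t₂≡0 : t₂ ≡ 0
  t₂≡0 with m*n≡0⇒m≡0∨n≡0 h ht₂≡0
  ... | inj₁ h≡0 = contradiction h≡0 (>⇒≢ 1≤h)
  ... | inj₂ t₂≡0 = t₂≡0

module Semigroup (a h d j k t : ℕ) (2<a : 2 < a) (2<j : 2 < j) (1≤k : 1 ≤ k) (t<j : t < j)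
                 (a+t≡k*j : a + t ≡ k * j) (gcd[a,d]≡1 : ℕ.gcd a d ≡ 1) where

  open import Data.Vec using (_∷_; [])

  instance
    a≢0 : NonZero a
    a≢0 = ℕ.>-nonZero (<-trans ℕ.z<s 2<a)
    j≢0 : NonZero j
    j≢0 = ℕ.>-nonZero (<-trans ℕ.z<s 2<j)
    k≢0 : NonZero k
    k≢0 = ℕ.>-nonZero 1≤k

  open CoinCount j

  A : Vec ℕ 3
  A = a ∷ h * a + d ∷ h * a + j * d ∷ []

  w : ℕ → ℕ
  w s = N s * h * a + s * d

  -- From s + l k j = (s + l a) + l t one gets N s + l k ≤ N (s + l a) + l t; then use h t ≤ h k + d.
  cost-bound : h * t ≤ h * k + d → ∀ s l → h * N s ≤ h * N (s + l * a) + l * d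
  cost-bound ht≤hk+d s l = cost-scaling {h} {N s} {N (s + l * a)} {l} {k} {t} {d} (begin
      N s + l * k           ≡⟨ N-+* s (l * k) ⟨
      N (s + l * k * j)     ≡⟨ cong N (trans (cong (s +_) lkj≡) (sym (+-assoc s (l * a) (l * t)))) ⟩
      N (s + l * a + l * t) ≤⟨ N-+-≤ (s + l * a) (l * t) ⟩
      N (s + l * a) + l * t ∎) ht≤hk+d
    where
    open ≤-Reasoning
    lkj≡ : l * k * j ≡ l * a + l * t
    lkj≡ = trans (*-assoc l k j) (trans (cong (l *_) (sym a+t≡k*j)) (*-distribˡ-+ l a t))

  apery-form : h * t ≤ h * k + d → ∀ x₀ x₁ x₂ →
    ∃₂ λ s i → s < a × a * x₀ + ((h * a + d) * x₁ + ((h * a + j * d) * x₂ + 0)) ≡ w s + i * a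
  apery-form ht≤hk+d x₀ x₁ x₂ =
    s , x₀ + δ , m%n<n u a , apery-form-arith a h d j x₀ x₁ x₂ s l (N s) δ u≡s+la (m+[n∸m]≡n cost≤)
    where
    u s l δ : ℕ
    u = x₁ + x₂ * j
    s = u % a
    l = u / a
    u≡s+la : u ≡ s + l * a
    u≡s+la = m≡m%n+[m/n]*n u a
    cost≤ : h * N s ≤ h * (x₁ + x₂) + l * d
    cost≤ = ≤-trans (cost-bound ht≤hk+d s l)
                    (+-monoˡ-≤ (l * d) (*-monoʳ-≤ h (subst (λ v → N v ≤ x₁ + x₂) u≡s+la (N-minimal x₁ x₂))))
    δ = h * (x₁ + x₂) + l * d ∸ h * N s

  apery-combination : ∀ s i → a * i + ((h * a + d) * (s % j) + ((h * a + j * d) * (s / j) + 0)) ≡ w s + i * a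
  apery-combination s i = trans (apery-combination-arith a h d j i (s % j) (s / j))
                                (cong (λ x → N s * h * a + x * d + i * a) (sym (m≡m%n+[m/n]*n s j)))

  representable⇔ : h * t ≤ h * k + d → ∀ m → Representable A m ⇔ ∃₂ λ s i → s < a × m ≡ w s + i * a
  representable⇔ ht≤hk+d m = mk⇔ to from
    where
    to : Representable A m → ∃₂ λ s i → s < a × m ≡ w s + i * a
    to ((x₀ ∷ x₁ ∷ x₂ ∷ []) , x·A≡m) =
      let s , i , s<a , x·A≡ = apery-form ht≤hk+d x₀ x₁ x₂ in s , i , s<a , trans (sym x·A≡m) x·A≡
    from : (∃₂ λ s i → s < a × m ≡ w s + i * a) → Representable A m
    from (s , i , _ , m≡) = (i ∷ s % j ∷ s / j ∷ []) , trans (apery-combination s i) (sym m≡)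

  w%a : ∀ s → w s % a ≡ s * d % a
  w%a s = trans (cong (_% a) (+-comm (N s * h * a) (s * d))) ([m+kn]%n≡m%n (s * d) (N s * h) a)

  1<a : 1 < a
  1<a = <-trans (s≤s (s≤s z≤n)) 2<a

  d⁻¹ : ∃ λ e → ∀ x → x * d * e % a ≡ x % a
  d⁻¹ = %-inverse (coprime⇒inverse 1<a gcd[a,d]≡1)

  residue-injective : ∀ {s s′} → s < a → s′ < a → w s % a ≡ w s′ % a → s ≡ s′
  residue-injective {s} {s′} s<a s′<a ws≡ws′ = begin
    s                  ≡⟨ m<n⇒m%n≡m s<a ⟨
    s % a              ≡⟨ proj₂ d⁻¹ s ⟨
    s * d * e % a      ≡⟨ [x%a*y]%a≡[x*y]%a (s * d) e ⟨
    s * d % a * e % a  ≡⟨ cong (λ x → x * e % a) (trans (sym (w%a s)) (trans ws≡ws′ (w%a s′))) ⟩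
    s′ * d % a * e % a ≡⟨ [x%a*y]%a≡[x*y]%a (s′ * d) e ⟩
    s′ * d * e % a     ≡⟨ proj₂ d⁻¹ s′ ⟩
    s′ % a             ≡⟨ m<n⇒m%n≡m s′<a ⟩
    s′                 ∎
    where
    open ≡-Reasoning
    e : ℕ
    e = proj₁ d⁻¹

  residue-surjective : ∀ m → ∃ λ s → s < a × w s % a ≡ m % a
  residue-surjective m = m * e % a , m%n<n (m * e) a , (begin
    w (m * e % a) % a  ≡⟨ w%a (m * e % a) ⟩
    m * e % a * d % a  ≡⟨ [x%a*y]%a≡[x*y]%a (m * e) d ⟩
    m * e * d % a      ≡⟨ cong (_% a) (*-right-comm m e d) ⟩
    m * d * e % a      ≡⟨ proj₂ d⁻¹ m ⟩
    m % a              ∎)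
    where
    open ≡-Reasoning
    e : ℕ
    e = proj₁ d⁻¹

  module Apery (ht≤hk+d : h * t ≤ h * k + d) =
    AperySet A a w (representable⇔ ht≤hk+d) residue-injective residue-surjective

  -- a = R + K j with 0 < R ≤ j: the residues s < a fill K blocks of length j and one of length R.
  K R : ℕ
  K = pred k
  R = j ∸ t

  k≡1+K : k ≡ suc K
  k≡1+K = sym (suc-pred k)

  j≡R+t : j ≡ R + t
  j≡R+t = sym (m∸n+n≡m (<⇒≤ t<j))

  a≡R+K*j : a ≡ R + K * j
  a≡R+K*j = +-cancelʳ-≡ t a (R + K * j) (begin
    a + t          ≡⟨ a+t≡k*j ⟩
    k * j          ≡⟨ cong (_* j) k≡1+K ⟩
    j + K * j      ≡⟨ cong (_+ K * j) j≡R+t ⟩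
    R + t + K * j  ≡⟨ +-right-comm R t (K * j) ⟩
    R + K * j + t  ∎)
    where open ≡-Reasoning

  R≤j : R ≤ j
  R≤j = m∸n≤m j t

  pred[j]<j : pred j < j
  pred[j]<j = subst (pred j <_) (suc-pred j) (n<1+n (pred j))

  1≤h : d ≤ h → 1 ≤ h
  1≤h d≤h = ≤-trans (gcd≡1⇒1≤d 1<a gcd[a,d]≡1) d≤h

  w-mono : ∀ {s s′} → N s ≤ N s′ → s ≤ s′ → w s ≤ w s′
  w-mono Ns≤Ns′ s≤s′ = +-mono-≤ (*-monoˡ-≤ a (*-monoˡ-≤ h Ns≤Ns′)) (*-monoˡ-≤ d s≤s′)

  a≤w : d ≤ h → ∀ {s} → 1 ≤ N s → a ≤ w s
  a≤w d≤h {s} 1≤Ns = begin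
    a             ≡⟨ *-identityˡ a ⟨
    1 * a         ≤⟨ *-monoˡ-≤ a (*-mono-≤ 1≤Ns (1≤h d≤h)) ⟩
    N s * h * a   ≤⟨ m≤m+n (N s * h * a) (s * d) ⟩
    w s           ∎
    where open ≤-Reasoning

  isFrobenius-top : d ≤ h → h * t ≤ h * k + d → ∀ {r} → r < j → j ≤ suc (suc r) → a ≡ suc (r + K * j) →
                    1 ≤ r + K → IsFrobenius A (w (r + K * j) ∸ a)
  isFrobenius-top d≤h ht≤hk+d {r} r<j j≤r+2 a≡ 1≤r+K =
    Apery.isFrobenius ht≤hk+d (subst (r + K * j <_) (sym a≡) ≤-refl) (a≤w d≤h (subst (1 ≤_) (sym N≡) 1≤r+K)) maximal
    where
    N≡ : N (r + K * j) ≡ r + K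
    N≡ = N-digits K r<j
    maximal : ∀ {s} → s < a → w s ≤ w (r + K * j)
    maximal {s} s<a = w-mono (subst (N s ≤_) (sym N≡) (N-max r<j j≤r+2 s≤)) s≤
      where
      s≤ : s ≤ r + K * j
      s≤ = ≤-pred (subst (s <_) a≡ s<a)

  -- Compared with the end s₂ of the previous block, s = ρ + (K′ + 1) j uses j - 2 - ρ ≥ 1 fewer
  -- copies of h a but ρ + 1 more copies of d, and (ρ + 1) d ≤ a h.
  w-last-block : d ≤ h → ∀ {ρ K′} → 3 + ρ ≤ j → suc ρ ≤ a → w (ρ + suc K′ * j) ≤ w (pred j + K′ * j)
  w-last-block d≤h {ρ} {K′} 3+ρ≤j ρ<a = +-cancelʳ-≤ (suc ρ * d) (w s) (w s₂) (begin
    w s + suc ρ * d          ≤⟨ +-monoʳ-≤ (w s) (≤-trans ρd≤ha (m≤n*m (h * a) (suc c))) ⟩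
    w s + suc c * (h * a)    ≡⟨ cong (λ n → n * h * a + s * d + suc c * (h * a)) (N-digits (suc K′) ρ<j) ⟩
    (ρ + suc K′) * h * a + s * d + suc c * (h * a)
      ≡⟨ last-block-arith ρ c K′ h a d (sym (suc-pred j)) (cong pred (sym (m+[n∸m]≡n 3+ρ≤j))) ⟨
    (pred j + K′) * h * a + s₂ * d + suc ρ * d
      ≡⟨ cong (λ n → n * h * a + s₂ * d + suc ρ * d) (N-digits K′ pred[j]<j) ⟨
    w s₂ + suc ρ * d         ∎)
    where
    open ≤-Reasoning
    s s₂ c : ℕ
    s = ρ + suc K′ * j
    s₂ = pred j + K′ * j
    c = j ∸ (3 + ρ)
    ρ<j : ρ < j
    ρ<j = ≤-trans (n≤1+n (suc ρ)) (≤-trans (n≤1+n (2 + ρ)) 3+ρ≤j)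
    ρd≤ha : suc ρ * d ≤ h * a
    ρd≤ha = subst (suc ρ * d ≤_) (*-comm a h) (*-mono-≤ ρ<a d≤h)

  qa qh qd qj qk qt qK qR : ℚ
  qa = ℕ→ℚ a
  qh = ℕ→ℚ h
  qd = ℕ→ℚ d
  qj = ℕ→ℚ j
  qk = ℕ→ℚ k
  qt = ℕ→ℚ t
  qK = ℕ→ℚ K
  qR = ℕ→ℚ R

  qk≡qK+1 : qk ≡ qK ℚ.+ 1ℚ
  qk≡qK+1 = trans (cong ℕ→ℚ k≡1+K) (ℕ→ℚ-suc K)

  /ℕj-cancel : ∀ x {y} → y ≡ qk ℚ.* qj → (x ℚ.* y) /ℕ j ≡ x ℚ.* qk
  /ℕj-cancel x y≡ = trans (cong (λ y → (x ℚ.* y) /ℕ j) y≡)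
                          (trans (cong (_/ℕ j) (sym (ℚ.*-assoc x qk qj))) (*-/ℕ-cancel j (x ℚ.* qk)))

  ℕ→ℚ-w : ∀ s → ℕ→ℚ (w s) ≡ ℕ→ℚ (N s) ℚ.* qh ℚ.* qa ℚ.+ ℕ→ℚ s ℚ.* qd
  ℕ→ℚ-w s = trans (ℕ→ℚ-+ (N s * h * a) (s * d))
                  (cong₂ ℚ._+_ (trans (ℕ→ℚ-* (N s * h) a) (cong (ℚ._* qa) (ℕ→ℚ-* (N s) h))) (ℕ→ℚ-* s d))

  frobenius-value : ∀ {s n} → a ≤ w s → N s ≡ n → ℕ→ℚ (w s ∸ a) ≡ ℕ→ℚ n ℚ.* qh ℚ.* qa ℚ.+ ℕ→ℚ s ℚ.* qd ℚ.- qa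
  frobenius-value {s} a≤ws Ns≡n = trans
    (x≡y+z⇒z≡x-y qa (ℕ→ℚ (w s ∸ a)) (trans (cong ℕ→ℚ (sym (m+[n∸m]≡n a≤ws))) (ℕ→ℚ-+ a (w s ∸ a))))
    (cong (ℚ._- qa) (trans (ℕ→ℚ-w s) (cong (λ n → ℕ→ℚ n ℚ.* qh ℚ.* qa ℚ.+ ℕ→ℚ s ℚ.* qd) Ns≡n)))

  frobenius-value-digits : ∀ {r q} → r < j → a ≤ w (r + q * j) →
    ℕ→ℚ (w (r + q * j) ∸ a) ≡ (ℕ→ℚ r ℚ.+ ℕ→ℚ q) ℚ.* qh ℚ.* qa ℚ.+ (ℕ→ℚ r ℚ.+ ℕ→ℚ q ℚ.* qj) ℚ.* qd ℚ.- qa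
  frobenius-value-digits {r} {q} r<j a≤w = trans (frobenius-value {r + q * j} a≤w (N-digits q r<j))
    (cong₂ (λ x y → x ℚ.* qh ℚ.* qa ℚ.+ y ℚ.* qd ℚ.- qa) (ℕ→ℚ-+ r q) (ℕ→ℚ-+* r q j))

  r₁ : ℕ
  r₁ = pred R

  R≡1+r₁ : R ≡ suc r₁
  R≡1+r₁ = sym (suc-pred R {{ℕ.>-nonZero (m<n⇒0<n∸m t<j)}})

  module _ (t≤1 : t ≤ 1) where

    ht≤hk+d-t≤1 : h * t ≤ h * k + d
    ht≤hk+d-t≤1 = ≤-trans (*-monoʳ-≤ h t≤1) (≤-trans (*-monoʳ-≤ h 1≤k) (m≤m+n (h * k) d))

    r₁<j : r₁ < j
    r₁<j = subst (_≤ j) R≡1+r₁ R≤j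

    j≤2+r₁ : j ≤ suc (suc r₁)
    j≤2+r₁ = begin
      j             ≡⟨ j≡R+t ⟩
      R + t         ≤⟨ +-monoʳ-≤ R t≤1 ⟩
      R + 1         ≡⟨ +-comm R 1 ⟩
      suc R         ≡⟨ cong suc R≡1+r₁ ⟩
      suc (suc r₁)  ∎
      where open ≤-Reasoning

    a≡1+r₁+K*j : a ≡ suc (r₁ + K * j)
    a≡1+r₁+K*j = trans a≡R+K*j (cong (_+ K * j) R≡1+r₁)

    1≤r₁+K : 1 ≤ r₁ + K
    1≤r₁+K = ≤-trans (≤-pred (≤-pred (≤-trans 2<j j≤2+r₁))) (m≤m+n r₁ K)

    frobenius-t≤1 : d ≤ h → IsFrobenius A (w (r₁ + K * j) ∸ a)
    frobenius-t≤1 d≤h = isFrobenius-top d≤h ht≤hk+d-t≤1 r₁<j j≤2+r₁ a≡1+r₁+K*j 1≤r₁+K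

    value-t≤1 : d ≤ h → ℕ→ℚ (w (r₁ + K * j) ∸ a) ≡
                (ℕ→ℚ r₁ ℚ.+ qK) ℚ.* qh ℚ.* qa ℚ.+ (ℕ→ℚ r₁ ℚ.+ qK ℚ.* qj) ℚ.* qd ℚ.- qa
    value-t≤1 d≤h = frobenius-value-digits {r₁} {K} r₁<j (a≤w d≤h (subst (1 ≤_) (sym (N-digits K r₁<j)) 1≤r₁+K))

    qa≡r₁+K*j+1 : qa ≡ ℕ→ℚ r₁ ℚ.+ qK ℚ.* qj ℚ.+ 1ℚ
    qa≡r₁+K*j+1 = trans (cong ℕ→ℚ a≡1+r₁+K*j) (trans (ℕ→ℚ-suc (r₁ + K * j)) (cong (ℚ._+ 1ℚ) (ℕ→ℚ-+* r₁ K j)))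

  frobenius-t≡0 : d ≤ h → t ≡ 0 →
    ∃ λ g → IsFrobenius A g × ℕ→ℚ g ≡ g-formula-t≡0 ((qh ℚ.* qa ℚ.* qa) /ℕ j) qa qh qd qj
  frobenius-t≡0 d≤h t≡0 = _ , frobenius-t≤1 t≤1 d≤h ,
    frobenius-identity-t≡0 {K = qK} {ℕ→ℚ r₁} qj≡r₁+1 qk≡qK+1 (qa≡r₁+K*j+1 t≤1)
      (/ℕj-cancel (qh ℚ.* qa) qa≡k*j) (value-t≤1 t≤1 d≤h)
    where
    t≤1 : t ≤ 1
    t≤1 = subst (_≤ 1) (sym t≡0) z≤n
    qj≡r₁+1 : qj ≡ ℕ→ℚ r₁ ℚ.+ 1ℚ
    qj≡r₁+1 = trans (cong ℕ→ℚ (trans j≡R+t (trans (cong (R +_) t≡0) (trans (+-identityʳ R) R≡1+r₁)))) (ℕ→ℚ-suc r₁)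
    qa≡k*j : qa ≡ qk ℚ.* qj
    qa≡k*j = trans (cong ℕ→ℚ (trans (sym (+-identityʳ a)) (trans (cong (a +_) (sym t≡0)) a+t≡k*j))) (ℕ→ℚ-* k j)

  frobenius-t≡1 : d ≤ h → t ≡ 1 →
    ∃ λ g → IsFrobenius A g × ℕ→ℚ g ≡ g-formula-t≡1 ((qh ℚ.* qa ℚ.* (qa ℚ.+ ℕ→ℚ 1)) /ℕ j) qa qh qd qj
  frobenius-t≡1 d≤h t≡1 = _ , frobenius-t≤1 t≤1 d≤h ,
    frobenius-identity-t≡1 {K = qK} {ℕ→ℚ r₁} qj≡r₁+2 qk≡qK+1 (qa≡r₁+K*j+1 t≤1)
      (/ℕj-cancel (qh ℚ.* qa) qa+1≡k*j) (value-t≤1 t≤1 d≤h)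
    where
    t≤1 : t ≤ 1
    t≤1 = subst (_≤ 1) (sym t≡1) ≤-refl
    qj≡r₁+2 : qj ≡ ℕ→ℚ r₁ ℚ.+ 1ℚ ℚ.+ 1ℚ
    qj≡r₁+2 = begin
      qj                       ≡⟨ cong ℕ→ℚ (trans j≡R+t (trans (cong (R +_) t≡1) (trans (+-comm R 1) (cong suc R≡1+r₁)))) ⟩
      ℕ→ℚ (suc (suc r₁))       ≡⟨ ℕ→ℚ-suc (suc r₁) ⟩
      ℕ→ℚ (suc r₁) ℚ.+ 1ℚ      ≡⟨ cong (ℚ._+ 1ℚ) (ℕ→ℚ-suc r₁) ⟩
      ℕ→ℚ r₁ ℚ.+ 1ℚ ℚ.+ 1ℚ     ∎
      where open ≡-Reasoning
    qa+1≡k*j : qa ℚ.+ ℕ→ℚ 1 ≡ qk ℚ.* qj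
    qa+1≡k*j = trans (sym (ℕ→ℚ-+ a 1)) (trans (cong ℕ→ℚ (trans (cong (a +_) (sym t≡1)) a+t≡k*j)) (ℕ→ℚ-* k j))

  ⌊a/j⌋≡K : 1 ≤ t → ℚ.floor (qa /ℕ j) ℚ./ 1 ≡ qK
  ⌊a/j⌋≡K 1≤t = cong (ℚ._/ 1) (trans (floor-/ℕ a j) (cong ℤ.+_ (trans (cong (_/ j) a≡R+K*j) ([r+q*a]/a≡q K R<j))))
    where
    R<j : R < j
    R<j = subst (R <_) (sym j≡R+t) (m<m+n R 1≤t)

  frobenius-k≡1 : d ≤ h → 2 ≤ t → h * t ≤ h * k + d → K ≡ 0 →
    ∃ λ g → IsFrobenius A g × ℕ→ℚ g ≡ g-formula-t≥2 (ℚ.floor (qa /ℕ j) ℚ./ 1) qa qh qd qj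
  frobenius-k≡1 d≤h 2≤t ht≤hk+d K≡0 = _ , Apery.isFrobenius ht≤hk+d pred[a]<a (a≤w d≤h 1≤N[pred[a]]) maximal ,
    frobenius-identity-k≡1 {r = ℕ→ℚ (pred a)} qa≡pred[a]+1 qj≡a+2 (cong ℕ→ℚ (proj₂ t≡2∧d≡h))
      (trans (⌊a/j⌋≡K (≤-trans (s≤s z≤n) 2≤t)) (cong ℕ→ℚ K≡0))
      (frobenius-value {pred a} (a≤w d≤h 1≤N[pred[a]]) (N-small (<-trans pred[a]<a a<j)))
    where
    t≡2∧d≡h : t ≡ 2 × d ≡ h
    t≡2∧d≡h = k≡1⇒t≡2∧d≡h (1≤h d≤h) d≤h 2≤t (subst (λ k → h * t ≤ h * k + d) (trans k≡1+K (cong suc K≡0)) ht≤hk+d)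
    j≡a+2 : j ≡ a + 2
    j≡a+2 = trans j≡R+t (cong₂ _+_ (sym (trans a≡R+K*j (trans (cong (λ K → R + K * j) K≡0) (+-identityʳ R))))
                                   (proj₁ t≡2∧d≡h))
    a<j : a < j
    a<j = subst (a <_) (sym j≡a+2) (m<m+n a (s≤s z≤n))
    pred[a]<a : pred a < a
    pred[a]<a = subst (pred a <_) (suc-pred a) (n<1+n (pred a))
    1≤N[pred[a]] : 1 ≤ N (pred a)
    1≤N[pred[a]] = subst (1 ≤_) (sym (N-small (<-trans pred[a]<a a<j)))
                         (≤-trans (s≤s z≤n) (≤-pred (subst (2 <_) (sym (suc-pred a)) 2<a)))
    maximal : ∀ {s} → s < a → w s ≤ w (pred a)
    maximal {s} s<a = w-mono (subst₂ _≤_ (sym (N-small (<-trans s<a a<j))) (sym (N-small (<-trans pred[a]<a a<j))) s≤)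
                             s≤
      where
      s≤ : s ≤ pred a
      s≤ = ≤-pred (subst (s <_) (sym (suc-pred a)) s<a)
    qa≡pred[a]+1 : qa ≡ ℕ→ℚ (pred a) ℚ.+ 1ℚ
    qa≡pred[a]+1 = trans (cong ℕ→ℚ (sym (suc-pred a))) (ℕ→ℚ-suc (pred a))
    qj≡a+2 : qj ≡ qa ℚ.+ ℕ→ℚ 2
    qj≡a+2 = trans (cong ℕ→ℚ j≡a+2) (ℕ→ℚ-+ a 2)

  end-of-block-maximal : d ≤ h → 2 ≤ t → ∀ {K′} → K ≡ suc K′ → ∀ {s} → s < a → w s ≤ w (pred j + K′ * j)
  end-of-block-maximal d≤h 2≤t {K′} K≡1+K′ {s} s<a with s ≤? pred j + K′ * j
  ... | yes s≤s₂ = w-mono (subst (N s ≤_) (sym (N-digits K′ pred[j]<j))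
                                 (N-max pred[j]<j (subst (_≤ suc (suc (pred j))) (suc-pred j) (n≤1+n _)) s≤s₂)) s≤s₂
  ... | no s≰s₂ = subst (λ x → w x ≤ w (pred j + K′ * j)) ρ+Kj≡s (w-last-block d≤h {ρ} {K′} 3+ρ≤j (≤-trans ρ<R R≤a))
    where
    K*j≤s : K * j ≤ s
    K*j≤s = subst (_≤ s) (trans (cong (_+ K′ * j) (suc-pred j)) (cong (_* j) (sym K≡1+K′))) (≰⇒> s≰s₂)
    ρ : ℕ
    ρ = s ∸ K * j
    ρ+Kj≡s : ρ + suc K′ * j ≡ s
    ρ+Kj≡s = trans (cong (λ K → ρ + K * j) (sym K≡1+K′)) (m∸n+n≡m K*j≤s)
    ρ<R : ρ < R
    ρ<R = +-cancelʳ-< (K * j) ρ R (subst₂ _<_ (sym (m∸n+n≡m K*j≤s)) a≡R+K*j s<a)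
    R≤a : R ≤ a
    R≤a = subst (R ≤_) (sym a≡R+K*j) (m≤m+n R (K * j))
    3+ρ≤j : 3 + ρ ≤ j
    3+ρ≤j = begin
      3 + ρ   ≤⟨ +-monoʳ-≤ 2 ρ<R ⟩
      2 + R   ≤⟨ +-monoˡ-≤ R 2≤t ⟩
      t + R   ≡⟨ +-comm t R ⟩
      R + t   ≡⟨ j≡R+t ⟨
      j       ∎
      where open ≤-Reasoning

  frobenius-k≥2 : d ≤ h → 2 ≤ t → h * t ≤ h * k + d → ∀ {K′} → K ≡ suc K′ →
    ∃ λ g → IsFrobenius A g × ℕ→ℚ g ≡ g-formula-t≥2 (ℚ.floor (qa /ℕ j) ℚ./ 1) qa qh qd qj
  frobenius-k≥2 d≤h 2≤t ht≤hk+d {K′} K≡1+K′ =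
    _ , Apery.isFrobenius ht≤hk+d s₂<a (a≤w d≤h 1≤N[s₂]) (end-of-block-maximal d≤h 2≤t K≡1+K′) ,
    frobenius-identity-t≥2 {K = ℕ→ℚ K′} {ℕ→ℚ (pred j)} qj≡pred[j]+1
      (trans (⌊a/j⌋≡K (≤-trans (s≤s z≤n) 2≤t)) (trans (cong ℕ→ℚ K≡1+K′) (ℕ→ℚ-suc K′)))
      (frobenius-value-digits {pred j} {K′} pred[j]<j (a≤w d≤h 1≤N[s₂]))
    where
    s₂ : ℕ
    s₂ = pred j + K′ * j
    s₂<a : s₂ < a
    s₂<a = subst (s₂ <_) (sym a≡R+K*j)
             (≤-trans (≤-reflexive (trans (cong (_+ K′ * j) (suc-pred j)) (cong (_* j) (sym K≡1+K′)))) (m≤n+m (K * j) R))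
    1≤N[s₂] : 1 ≤ N s₂
    1≤N[s₂] = subst (1 ≤_) (sym (N-digits K′ pred[j]<j))
                    (≤-trans (≤-trans (s≤s z≤n) (≤-pred (subst (2 <_) (sym (suc-pred j)) 2<j))) (m≤m+n (pred j) K′))
    qj≡pred[j]+1 : qj ≡ ℕ→ℚ (pred j) ℚ.+ 1ℚ
    qj≡pred[j]+1 = trans (cong ℕ→ℚ (sym (suc-pred j))) (ℕ→ℚ-suc (pred j))

  frobenius-t≥2 : d ≤ h → 2 ≤ t → h * t ≤ h * k + d →
    ∃ λ g → IsFrobenius A g × ℕ→ℚ g ≡ g-formula-t≥2 (ℚ.floor (qa /ℕ j) ℚ./ 1) qa qh qd qj
  frobenius-t≥2 d≤h 2≤t ht≤hk+d with K in K≡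
  ... | zero   = frobenius-k≡1 d≤h 2≤t ht≤hk+d K≡
  ... | suc K′ = frobenius-k≥2 d≤h 2≤t ht≤hk+d K≡

  ∑N≡ : ∑[ s < a ] ℕ→ℚ (N s) ≡ ∑N-poly qj qK qR
  ∑N≡ = subst (λ n → ∑[ s < n ] ℕ→ℚ (N s) ≡ ∑N-poly qj qK qR) (sym a≡R+K*j) (∑<-N-closed-form ∑N-recurrence K R R≤j)

  ∑N²≡ : ∑[ s < a ] (ℕ→ℚ (N s) ℚ.* ℕ→ℚ (N s)) ≡ ∑N²-poly qj qK qR
  ∑N²≡ = subst (λ n → ∑[ s < n ] (ℕ→ℚ (N s) ℚ.* ℕ→ℚ (N s)) ≡ ∑N²-poly qj qK qR) (sym a≡R+K*j)
               (∑<-N-closed-form ∑N²-recurrence K R R≤j)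

  ∑Ns≡ : ∑[ s < a ] (ℕ→ℚ (N s) ℚ.* ℕ→ℚ s) ≡ ∑Ns-poly qj qK qR
  ∑Ns≡ = subst (λ n → ∑[ s < n ] (ℕ→ℚ (N s) ℚ.* ℕ→ℚ s) ≡ ∑Ns-poly qj qK qR) (sym a≡R+K*j)
               (∑<-N-closed-form ∑Ns-recurrence K R R≤j)

  ∑w≡ : ∑[ s < a ] ℕ→ℚ (w s) ≡ ∑N-poly qj qK qR ℚ.* qh ℚ.* qa ℚ.+ tri qa ℚ.* qd
  ∑w≡ = begin
    ∑[ s < a ] ℕ→ℚ (w s)                                      ≡⟨ ∑<-cong a ℕ→ℚ-w ⟩
    ∑[ s < a ] (ℕ→ℚ (N s) ℚ.* qh ℚ.* qa ℚ.+ ℕ→ℚ s ℚ.* qd)     ≡⟨ ∑<-+ a (λ s → ℕ→ℚ (N s) ℚ.* qh ℚ.* qa) (λ s → ℕ→ℚ s ℚ.* qd) ⟩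
    ∑[ s < a ] (ℕ→ℚ (N s) ℚ.* qh ℚ.* qa) ℚ.+ ∑[ s < a ] (ℕ→ℚ s ℚ.* qd)
      ≡⟨ cong₂ ℚ._+_ (trans (∑<-*ʳ a qa (λ s → ℕ→ℚ (N s) ℚ.* qh)) (cong (ℚ._* qa) (∑<-*ʳ a qh (λ s → ℕ→ℚ (N s)))))
                     (∑<-*ʳ a qd ℕ→ℚ) ⟩
    ∑[ s < a ] ℕ→ℚ (N s) ℚ.* qh ℚ.* qa ℚ.+ ∑[ s < a ] ℕ→ℚ s ℚ.* qd
      ≡⟨ cong₂ (λ x y → x ℚ.* qh ℚ.* qa ℚ.+ y ℚ.* qd) ∑N≡ (∑<-id a) ⟩
    ∑N-poly qj qK qR ℚ.* qh ℚ.* qa ℚ.+ tri qa ℚ.* qd ∎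
    where open ≡-Reasoning

  ∑w²≡ : ∑[ s < a ] (ℕ→ℚ (w s) ℚ.* ℕ→ℚ (w s)) ≡
         ∑N²-poly qj qK qR ℚ.* (qh ℚ.* qh ℚ.* qa ℚ.* qa) ℚ.+ ∑Ns-poly qj qK qR ℚ.* (ℕ→ℚ 2 ℚ.* qh ℚ.* qa ℚ.* qd)
           ℚ.+ pyr qa ℚ.* (qd ℚ.* qd)
  ∑w²≡ = begin
    ∑[ s < a ] (ℕ→ℚ (w s) ℚ.* ℕ→ℚ (w s))
      ≡⟨ ∑<-cong a (λ s → trans (cong₂ ℚ._*_ (ℕ→ℚ-w s) (ℕ→ℚ-w s)) (square-expansion (ℕ→ℚ (N s)) (ℕ→ℚ s) qh qa qd)) ⟩
    ∑[ s < a ] (N² s ℚ.* c₁ ℚ.+ Ns s ℚ.* c₂ ℚ.+ s² s ℚ.* c₃)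
      ≡⟨ ∑<-+ a (λ s → N² s ℚ.* c₁ ℚ.+ Ns s ℚ.* c₂) (λ s → s² s ℚ.* c₃) ⟩
    ∑[ s < a ] (N² s ℚ.* c₁ ℚ.+ Ns s ℚ.* c₂) ℚ.+ ∑[ s < a ] (s² s ℚ.* c₃)
      ≡⟨ cong (ℚ._+ ∑[ s < a ] (s² s ℚ.* c₃)) (∑<-+ a (λ s → N² s ℚ.* c₁) (λ s → Ns s ℚ.* c₂)) ⟩
    ∑[ s < a ] (N² s ℚ.* c₁) ℚ.+ ∑[ s < a ] (Ns s ℚ.* c₂) ℚ.+ ∑[ s < a ] (s² s ℚ.* c₃)
      ≡⟨ cong₂ ℚ._+_ (cong₂ ℚ._+_ (∑<-*ʳ a c₁ N²) (∑<-*ʳ a c₂ Ns)) (∑<-*ʳ a c₃ s²) ⟩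
    ∑< a N² ℚ.* c₁ ℚ.+ ∑< a Ns ℚ.* c₂ ℚ.+ ∑< a s² ℚ.* c₃
      ≡⟨ cong₂ ℚ._+_ (cong₂ ℚ._+_ (cong (ℚ._* c₁) ∑N²≡) (cong (ℚ._* c₂) ∑Ns≡)) (cong (ℚ._* c₃) (∑<-squares a)) ⟩
    ∑N²-poly qj qK qR ℚ.* c₁ ℚ.+ ∑Ns-poly qj qK qR ℚ.* c₂ ℚ.+ pyr qa ℚ.* c₃ ∎
    where
    open ≡-Reasoning
    N² Ns s² : ℕ → ℚ
    N² s = ℕ→ℚ (N s) ℚ.* ℕ→ℚ (N s)
    Ns s = ℕ→ℚ (N s) ℚ.* ℕ→ℚ s
    s² s = ℕ→ℚ s ℚ.* ℕ→ℚ s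
    c₁ c₂ c₃ : ℚ
    c₁ = qh ℚ.* qh ℚ.* qa ℚ.* qa
    c₂ = ℕ→ℚ 2 ℚ.* qh ℚ.* qa ℚ.* qd
    c₃ = qd ℚ.* qd

  qj≡qR+qt : qj ≡ qR ℚ.+ qt
  qj≡qR+qt = trans (cong ℕ→ℚ j≡R+t) (ℕ→ℚ-+ R t)

  qa≡qR+qK*qj : qa ≡ qR ℚ.+ qK ℚ.* qj
  qa≡qR+qK*qj = trans (cong ℕ→ℚ a≡R+K*j) (ℕ→ℚ-+* R K j)

  [a+t]/j≡k : (qa ℚ.+ qt) /ℕ j ≡ qk
  [a+t]/j≡k = trans (cong (_/ℕ j) (trans (sym (ℕ→ℚ-+ a t)) (trans (cong ℕ→ℚ a+t≡k*j) (ℕ→ℚ-* k j))))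
                    (*-/ℕ-cancel j qk)

  sylvester-number : (ht≤hk+d : h * t ≤ h * k + d) →
    ℕ→ℚ (length (Apery.gaps ht≤hk+d)) ≡ n-formula ((qa ℚ.+ qt) /ℕ j) qa qh qd qj qt
  sylvester-number ht≤hk+d = *-cancelʳ-ℕ→ℚ a (begin
    ℕ→ℚ (length gaps) ℚ.* qa                                  ≡⟨ selmer ⟩
    ∑[ s < a ] ℕ→ℚ (w s) ℚ.- tri qa                            ≡⟨ cong (ℚ._- tri qa) ∑w≡ ⟩
    ∑N-poly qj qK qR ℚ.* qh ℚ.* qa ℚ.+ tri qa ℚ.* qd ℚ.- tri qa
      ≡⟨ sylvester-number-identity {K = qK} {qR} {qt} qj≡qR+qt qk≡qK+1 qa≡qR+qK*qj [a+t]/j≡k ⟨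
    n-formula ((qa ℚ.+ qt) /ℕ j) qa qh qd qj qt ℚ.* qa       ∎)
    where
    open Apery ht≤hk+d
    open ≡-Reasoning

  sylvester-sum : (ht≤hk+d : h * t ≤ h * k + d) →
    ℕ→ℚ (sum (Apery.gaps ht≤hk+d)) ≡ s-formula ((qa ℚ.+ qt) /ℕ j) qa qh qd qj qk qt
  sylvester-sum ht≤hk+d = *-cancelʳ-ℕ→ℚ a (trans tripathi (trans
    (cong₂ (λ x y → (x ℚ.- qa ℚ.* y ℚ.- (pyr qa ℚ.- qa ℚ.* tri qa)) ℚ.* ½) ∑w²≡ ∑w≡)
    (sym (sylvester-sum-identity {K = qK} {qR} {qt} qj≡qR+qt qk≡qK+1 qa≡qR+qK*qj [a+t]/j≡k))))
    where open Apery ht≤hk+d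

open import Data.Nat using (ℕ; _+_; _*_; _≤_; _<_)
open import Data.Nat.GCD using (gcd)
open import Data.Integer using (+_)
open import Data.Rational as Q using (ℚ; floor)
open import Data.Vec using (Vec; _∷_; [])
open import Data.List using (List; length)
open import Data.Nat.ListAction using (sum)
open import Data.Product using (∃; _×_)
open import Relation.Binary.PropositionalEquality using (_≡_)

theorem3p4 : ∀ (a h d j k t : ℕ) → 2 < a → 2 < j → 1 ≤ k → t < j → a + t ≡ k * j
    → gcd a d ≡ 1 → d ≤ h
    → let A : Vec ℕ 3
          A = a ∷ h * a + d ∷ h * a + j * d ∷ []
          qa = ℕ→ℚ a
          qh = ℕ→ℚ h
          qd = ℕ→ℚ d
          qj = ℕ→ℚ j
          qk = ℕ→ℚ k
          qt = ℕ→ℚ t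
          c1 = ℕ→ℚ 1
          c2 = ℕ→ℚ 2
          c3 = ℕ→ℚ 3
          b = qh Q.* qa Q.+ qd
          n-formula = ((qa Q.- c1) Q.* (b Q.- c1)) /ℕ 2
              Q.- ((qh Q.* (qj Q.- c1) Q.* (qa Q.- qt)) /ℕ 2)
                  Q.* (((qa Q.+ qt) /ℕ j) Q.- c1)
          T1 = (b Q.* b Q.* (c2 Q.* qa Q.* qa Q.- c3 Q.* qa Q.+ c1)) /ℕ 12
          T2 = ((qh Q.* qh Q.* qa Q.* (qj Q.- c1) Q.* (qj Q.- c1) Q.* (qk Q.- c1)) /ℕ 6)
              Q.* (qj Q.* qk Q.* qk Q.- (qj Q.* qk) /ℕ 2 Q.- c3 Q.* qt Q.* qk Q.+ c3 Q.* qt)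
          T3 = ((qh Q.* b Q.* (qj Q.- c1) Q.* (qk Q.- c1)) /ℕ 6)
              Q.* (c2 Q.* qj Q.* qj Q.* (qk Q.* qk Q.+ qk /ℕ 4)
                   Q.- c2 Q.* qk Q.* qj Q.* (c3 Q.* qt Q.+ c3 /ℕ 4)
                   Q.+ c3 Q.* qt Q.* (qt Q.+ c1))
          T4 = (qa Q.* b Q.* (qa Q.- c1)) /ℕ 4
          T5 = ((qh Q.* qa Q.* (qj Q.- c1) Q.* (qa Q.- qt)) /ℕ 4)
              Q.* (((qa Q.+ qt) /ℕ j) Q.- c1)
          T6 = (qa Q.* qa Q.- c1) /ℕ 12
          s-formula = T1 Q.+ T2 Q.- T3 Q.- T4 Q.+ T5 Q.+ T6
      in ((t ≡ 0 → ∃ λ g → IsFrobenius A g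
              × ℕ→ℚ g ≡ (qh Q.* qa Q.* qa) /ℕ j Q.+ (qj Q.- c2) Q.* qh Q.* qa
                        Q.+ (qa Q.- c1) Q.* qd Q.- qa)
         × (t ≡ 1 → ∃ λ g → IsFrobenius A g
              × ℕ→ℚ g ≡ (qh Q.* qa Q.* (qa Q.+ c1)) /ℕ j Q.+ (qj Q.- c3) Q.* qh Q.* qa
                        Q.+ (qa Q.- c1) Q.* qd Q.- qa)
         × (2 ≤ t → h * t ≤ h * k + d → ∃ λ g → IsFrobenius A g
              × ℕ→ℚ g ≡ ((floor (qa /ℕ j)) Q./ 1) Q.* (qh Q.* qa Q.+ qj Q.* qd)
                        Q.+ (qj Q.- c2) Q.* qh Q.* qa Q.- qd Q.- qa))
       × (h * t ≤ h * k + d → ∃ λ (L : List ℕ) → EnumeratesNR A L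
              × ℕ→ℚ (length L) ≡ n-formula
              × ℕ→ℚ (sum L) ≡ s-formula)
theorem3p4 a h d j k t 2<a 2<j 1≤k t<j a+t≡k*j gcd[a,d]≡1 d≤h =
  (frobenius-t≡0 d≤h , frobenius-t≡1 d≤h , frobenius-t≥2 d≤h) ,
  λ ht≤hk+d → Apery.gaps ht≤hk+d , Apery.gaps-enumerate ht≤hk+d , sylvester-number ht≤hk+d , sylvester-sum ht≤hk+d
  where open Semigroup a h d j k t 2<a 2<j 1≤k t<j a+t≡k*j gcd[a,d]≡1
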